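{- Let $k$ be a positive integer, let $G$ be a connected graph with weights $w:E(G)\to\mathbb{R}_+$, let $T$ be a spanning tree of $G$, and let $e^*\in E(T)$. If for every $e\in E(G)\setminus E(T)$ the graph $T+e$ contains no odd cycle of length at most $2k-1$, then $\mathrm{mac}(G)\ge\frac{w(G)}{2}+\frac{k-1}{2k}w(T)+\frac{1}{2k}w(e^*)$.
   Context: $\mathbb{R}_+$ denotes the non-negative reals; for a subgraph $H$, $w(H)=\sum_{e\in E(H)}w(e)$. $\mathrm{mac}(G)$ is the maximum total weight of the edges between $A$ and $B$ over all partitions $(A,B)$ of $V(G)$.
   Formalization: The edge weights take values in the nonnegative rationals instead of $\mathbb{R}_+$. -}

module Defs where

open import Data.Bool using (Bool; true; false; _∧_; _∨_; if_then_else_)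
open import Data.Nat as ℕ using (ℕ; suc; NonZero; _∸_)
open import Data.Nat.Properties using (m*n≢0)
open import Data.Fin using (Fin; toℕ; _≟_)
open import Data.Fin.Properties using () 
open import Data.List using (List; []; _∷_; _++_; length; map; allFin; foldr)
open import Data.List.Relation.Unary.Unique.Propositional using (Unique)
open import Data.List.Relation.Unary.Linked using (Linked)
open import Data.Integer using (+_)
open import Data.Rational as ℚ using (ℚ; 0ℚ; _+_; _/_)
open import Data.Product using (_×_; ∃-syntax)
open import Relation.Binary.PropositionalEquality using (_≡_)
open import Relation.Nullary using (¬_)
open import Relation.Nullary.Decidable using (⌊_⌋)

record Graph (n : ℕ) : Set where
  field
    adj    : Fin n → Fin n → Bool
    sym    : ∀ u v → adj u v ≡ adj v u
    irrefl : ∀ u → adj u u ≡ false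
open Graph public

Adj : ∀ {n} → (Fin n → Fin n → Bool) → Fin n → Fin n → Set
Adj E u v = E u v ≡ true

data Walk {n} (E : Fin n → Fin n → Bool) : Fin n → Fin n → Set where
  here : ∀ {u} → Walk E u u
  step : ∀ {u v w} → Adj E u v → Walk E v w → Walk E u w

Connected : ∀ {n} → (Fin n → Fin n → Bool) → Set
Connected E = ∀ u v → Walk E u v

IsCycle : ∀ {n} → (Fin n → Fin n → Bool) → List (Fin n) → Set
IsCycle E []       = Data.Empty.⊥ where import Data.Empty
IsCycle E (v ∷ vs) =
  3 ℕ.≤ length (v ∷ vs) × Unique (v ∷ vs) × Linked (Adj E) (v ∷ vs ++ v ∷ [])

Acyclic : ∀ {n} → (Fin n → Fin n → Bool) → Set
Acyclic E = ∀ c → ¬ IsCycle E c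

record SpanningTree {n} (G T : Graph n) : Set where
  field
    subgraph  : ∀ u v → Adj (adj T) u v → Adj (adj G) u v
    connected : Connected (adj T)
    acyclic   : Acyclic (adj T)

addEdge : ∀ {n} → (Fin n → Fin n → Bool) → Fin n → Fin n → Fin n → Fin n → Bool
addEdge E a b u v =
  E u v ∨ (⌊ u ≟ a ⌋ ∧ ⌊ v ≟ b ⌋) ∨ (⌊ u ≟ b ⌋ ∧ ⌊ v ≟ a ⌋)

HasShortOddCycle : ∀ {n} → (Fin n → Fin n → Bool) → ℕ → Set
HasShortOddCycle E m =
  ∃[ c ] IsCycle E c × length c ℕ.% 2 ≡ 1 × length c ℕ.≤ m

pairSum : ∀ {n} → (Fin n → Fin n → Bool) → (Fin n → Fin n → ℚ) → ℚ
pairSum {n} P w =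
  qsum (map (λ u → qsum (map (λ v →
        if P u v ∧ ⌊ toℕ u ℕ.<? toℕ v ⌋ then w u v else 0ℚ) (allFin n))) (allFin n))
  where qsum = foldr _+_ 0ℚ

weight : ∀ {n} → (Fin n → Fin n → Bool) → (Fin n → Fin n → ℚ) → ℚ
weight E w = pairSum E w

cutWeight : ∀ {n} → Graph n → (Fin n → Fin n → ℚ) → (Fin n → Bool) → ℚ
cutWeight G w A = pairSum (λ u v → adj G u v ∧ differ (A u) (A v)) w
  where
  differ : Bool → Bool → Bool
  differ true false = true
  differ false true = true
  differ _ _ = false

-- mac(G) ≥ x  :⇔  some partition (A,B) has cut weight ≥ x
-- (mac(G) is a maximum over the finitely many partitions)
MacAtLeast : ∀ {n} → Graph n → (Fin n → Fin n → ℚ) → ℚ → Set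
MacAtLeast G w x = ∃[ A ] x ℚ.≤ cutWeight G w A

coefA : (k : ℕ) → .{{NonZero k}} → ℚ
coefA k = (+ (k ∸ 1)) / (2 ℕ.* k) where instance _ = m*n≢0 2 k

coefB : (k : ℕ) → .{{NonZero k}} → ℚ
coefB k = (+ 1) / (2 ℕ.* k) where instance _ = m*n≢0 2 k

{-# OPTIONS --safe #-}
-- Root T at the edge ab by breadth-first search. Since T is acyclic, every other tree edge joins
-- a vertex to its parent one level closer to {a, b}, so the parity of the depth, flipped on b's
-- side, properly 2-colours T. In round r < k cut T below every level ≡ r (mod k): the pieces
-- (blocks) have height less than k, and a and b share one. An independent fair coin per block
-- decides whether to swap its two colour classes. Then ab is always cut; another tree edge is
-- always cut except in the one round separating its ends, where it is cut with probability at
-- least ½; an edge of G outside T is cut with probability ½ when its ends lie in different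
-- blocks, and surely when they lie in one block, because ends of equal colour would close, with
-- the walk between them inside the block, an odd closed walk of length at most 2k and hence an
-- odd cycle of length at most 2k − 1. Averaging over rounds and coins, the expected cut is at
-- least w(G)/2 + (k − 1)/(2k)·w(T) + w(ab)/(2k), so some cut reaches it.
module Submission where

module Walks where

  open import Defs hiding (sym)
  open import Data.Bool using (Bool; false; _∨_)
  open import Data.Bool.Properties using (∨-zeroʳ)
  open import Data.Empty using (⊥; ⊥-elim)
  open import Data.Fin using (Fin; _≟_)
  open import Data.List using (List; []; _∷_; _++_; length)
  open import Data.List.Membership.Propositional using (_∈_)
  open import Data.List.Relation.Unary.All using ([]; _∷_; head)
  open import Data.List.Relation.Unary.All.Properties using (¬Any⇒All¬; ++⁻ˡ; ++⁻ʳ)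
  open import Data.List.Relation.Unary.Any using (here; there)
  open import Data.List.Relation.Unary.Linked using (Linked; [-]; _∷_)
  open import Data.List.Relation.Unary.Unique.Propositional using (Unique; []; _∷_)
  open import Data.Nat using (ℕ; suc; _+_; _≤_; _<_; z≤n; s≤s; _%_; parity)
  open import Data.Nat.DivMod using ([m+n]%n≡m%n)
  open import Data.Nat.Induction using (<-wellFounded)
  open import Data.Nat.Properties
    using (≤-reflexive; ≤-trans; <⇒≤; +-comm; m≤m+n; m≤n+m; m<n+m; +-monoʳ-<)
  open import Data.Parity using (Parity; 0ℙ; 1ℙ; _⁻¹) renaming (_+_ to _⊕_)
  open import Data.Parity.Properties
    using (+-homo-+; suc-homo-⁻¹; ⁻¹-selfInverse) renaming (+-comm to ⊕-comm)
  open import Data.Product using (_×_; _,_; ∃₂)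
  open import Data.Sum using (_⊎_; inj₁; inj₂)
  open import Data.Unit using (⊤; tt)
  open import Induction.WellFounded using (Acc; acc)
  open import Relation.Binary.PropositionalEquality
  open import Relation.Nullary using (yes; no)

  ⊕-⁻¹-swap : ∀ p q → p ⊕ q ⁻¹ ≡ p ⁻¹ ⊕ q
  ⊕-⁻¹-swap 0ℙ q  = refl
  ⊕-⁻¹-swap 1ℙ 0ℙ = refl
  ⊕-⁻¹-swap 1ℙ 1ℙ = refl

  parity-suc : ∀ m → parity (suc m) ≡ parity m ⁻¹
  parity-suc m = sym (⁻¹-selfInverse (suc-homo-⁻¹ m))

  parity-split : ∀ l m r → parity (l + (m + r)) ≡ 1ℙ → parity m ≡ 1ℙ ⊎ parity (r + l) ≡ 1ℙ
  parity-split l m r odd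
    rewrite +-homo-+ l (m + r) | +-homo-+ m r | +-homo-+ r l =
      split-values (parity l) (parity m) (parity r) odd
    where
    split-values : ∀ p q s → p ⊕ (q ⊕ s) ≡ 1ℙ → q ≡ 1ℙ ⊎ s ⊕ p ≡ 1ℙ
    split-values p 1ℙ s _   = inj₁ refl
    split-values p 0ℙ s odd = inj₂ (trans (⊕-comm s p) odd)

  parity≡1ℙ⇒%2≡1 : ∀ m → parity m ≡ 1ℙ → m % 2 ≡ 1
  parity≡1ℙ⇒%2≡1 1               _   = refl
  parity≡1ℙ⇒%2≡1 (suc (suc m)) odd = begin
    suc (suc m) % 2 ≡⟨ cong (_% 2) (+-comm 2 m) ⟩
    (m + 2) % 2     ≡⟨ [m+n]%n≡m%n m 2 ⟩
    m % 2           ≡⟨ parity≡1ℙ⇒%2≡1 m odd ⟩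
    1               ∎
    where open ≡-Reasoning

  unique-rotate : ∀ {A : Set} (xs : List A) {y ys} → Unique (xs ++ y ∷ ys) → Unique (y ∷ xs)
  unique-rotate []       _          = [] ∷ []
  unique-rotate (x ∷ xs) (x∉ ∷ uq) with unique-rotate xs uq
  ... | y∉ ∷ uxs = (y≢x ∷ y∉) ∷ ++⁻ˡ xs x∉ ∷ uxs
    where
    y≢x = λ y≡x → head (++⁻ʳ xs x∉) (sym y≡x)

  module _ {n : ℕ} where

    open import Data.List.Membership.DecPropositional (_≟_ {n}) using (_∈?_)

    private
      variable
        E F : Fin n → Fin n → Bool
        u v w x y : Fin n

    infixr 5 _◅◅_

    _◅◅_ : Walk E u v → Walk E v w → Walk E u w
    here     ◅◅ W′ = W′
    step e W ◅◅ W′ = step e (W ◅◅ W′)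

    len : Walk E u v → ℕ
    len here       = 0
    len (step _ W) = suc (len W)

    stops : Walk E u v → List (Fin n)
    stops here               = []
    stops (step {u = u} _ W) = u ∷ stops W

    len-◅◅ : (W : Walk E u v) (W′ : Walk E v w) → len (W ◅◅ W′) ≡ len W + len W′
    len-◅◅ here       W′ = refl
    len-◅◅ (step _ W) W′ = cong suc (len-◅◅ W W′)

    stops-◅◅ : (W : Walk E u v) (W′ : Walk E v w) → stops (W ◅◅ W′) ≡ stops W ++ stops W′
    stops-◅◅ here       W′ = refl
    stops-◅◅ (step _ W) W′ = cong (_ ∷_) (stops-◅◅ W W′)

    length-stops : (W : Walk E u v) → length (stops W) ≡ len W
    length-stops here       = refl
    length-stops (step _ W) = cong suc (length-stops W)

    linked-stops : (W : Walk E u v) → Linked (Adj E) (stops W ++ v ∷ [])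
    linked-stops here                  = [-]
    linked-stops (step e here)         = e ∷ [-]
    linked-stops (step e (step e′ W)) = e ∷ linked-stops (step e′ W)

    map : (∀ {u v} → Adj E u v → Adj F u v) → Walk E u v → Walk F u v
    map f here       = here
    map f (step e W) = step (f e) (map f W)

    len-map : (f : ∀ {u v} → Adj E u v → Adj F u v) (W : Walk E u v) → len (map f W) ≡ len W
    len-map f here       = refl
    len-map f (step e W) = cong suc (len-map f W)

    reverse : (∀ {u v} → Adj E u v → Adj E v u) → Walk E u v → Walk E v u
    reverse flip here       = here
    reverse flip (step e W) = reverse flip W ◅◅ step (flip e) here

    len-reverse : (flip : ∀ {u v} → Adj E u v → Adj E v u) (W : Walk E u v) →
                  len (reverse flip W) ≡ len W
    len-reverse flip here       = refl
    len-reverse flip (step e W) = begin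
      len (reverse flip W ◅◅ step (flip e) here) ≡⟨ len-◅◅ (reverse flip W) _ ⟩
      len (reverse flip W) + 1                    ≡⟨ cong (_+ 1) (len-reverse flip W) ⟩
      len W + 1                                   ≡⟨ +-comm (len W) 1 ⟩
      suc (len W)                                 ∎
      where open ≡-Reasoning

    split : (W : Walk E u v) → x ∈ stops W →
            ∃₂ λ (W₁ : Walk E u x) (W₂ : Walk E x v) → W ≡ W₁ ◅◅ W₂ × 0 < len W₂
    split (step e W) (here refl) = here , step e W , refl , s≤s z≤n
    split (step e W) (there x∈) with split W x∈
    ... | W₁ , W₂ , refl , nonempty = step e W₁ , W₂ , refl , nonempty

    record SimpleLoopIn (W : Walk E u v) : Set where
      field
        {pivot}        : Fin n
        before         : Walk E u pivot
        loop           : Walk E pivot pivot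
        after          : Walk E pivot v
        splits         : W ≡ before ◅◅ loop ◅◅ after
        simple         : Unique (stops loop)
        loop-nonempty  : 0 < len loop
        after-nonempty : 0 < len after
    open SimpleLoopIn

    module _ {W : Walk E u v} (L : SimpleLoopIn W) where

      len-simpleLoopIn : len W ≡ len (before L) + (len (loop L) + len (after L))
      len-simpleLoopIn = trans (cong len (splits L))
        (trans (len-◅◅ (before L) _) (cong (len (before L) +_) (len-◅◅ (loop L) (after L))))

      len-loop≤ : len (loop L) ≤ len W
      len-loop≤ = subst (len (loop L) ≤_) (sym len-simpleLoopIn)
        (≤-trans (m≤m+n (len (loop L)) (len (after L))) (m≤n+m _ (len (before L))))

    len-rest< : {W : Walk E x x} (L : SimpleLoopIn W) → len (after L ◅◅ before L) < len W
    len-rest< L = subst₂ _<_ (sym (trans (len-◅◅ (after L) (before L)) (+-comm (len (after L)) _)))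
      (sym (len-simpleLoopIn L)) (+-monoʳ-< (len (before L)) (m<n+m (len (after L)) (loop-nonempty L)))

    unique⊎simpleLoop : (W : Walk E u v) → Unique (stops W) ⊎ SimpleLoopIn W
    unique⊎simpleLoop here = inj₁ []
    unique⊎simpleLoop (step {u = u} e W) with unique⊎simpleLoop W
    ... | inj₂ L = inj₂ record
      { before = step e (before L) ; loop = loop L ; after = after L
      ; splits = cong (step e) (splits L) ; simple = simple L
      ; loop-nonempty = loop-nonempty L ; after-nonempty = after-nonempty L }
    ... | inj₁ uniq with u ∈? stops W
    ...   | no u∉ = inj₁ (¬Any⇒All¬ _ u∉ ∷ uniq)
    ...   | yes u∈ with split W u∈
    ...     | W₁ , W₂@(step _ _) , refl , nonempty = inj₂ record
      { before = here ; loop = step e W₁ ; after = W₂ ; splits = refl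
      ; simple = unique-rotate (stops W₁) (subst Unique (stops-◅◅ W₁ W₂) uniq)
      ; loop-nonempty = s≤s z≤n ; after-nonempty = nonempty }

    simpleLoop⇒cycle : (C : Walk E x x) → Unique (stops C) → 3 ≤ len C → IsCycle E (stops C)
    simpleLoop⇒cycle C@(step _ _) uniq 3≤len =
      subst (3 ≤_) (sym (length-stops C)) 3≤len , uniq , linked-stops C

    NoStepTo : Fin n → Walk E u v → Set
    NoStepTo x here               = ⊤
    NoStepTo x (step {v = y} _ _) = x ≢ y

    NonBacktracking : Walk E u v → Set
    NonBacktracking here               = ⊤
    NonBacktracking (step {u = u} _ W) = NoStepTo u W × NonBacktracking W

    nonBacktracking-◅◅ˡ : (W : Walk E u v) {W′ : Walk E v w} →
                          NonBacktracking (W ◅◅ W′) → NonBacktracking W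
    nonBacktracking-◅◅ˡ here                _          = tt
    nonBacktracking-◅◅ˡ (step e here)       _          = tt , tt
    nonBacktracking-◅◅ˡ (step e W@(step _ _)) (u≢ , nb) = u≢ , nonBacktracking-◅◅ˡ W nb

    nonBacktracking-◅◅ʳ : (W : Walk E u v) {W′ : Walk E v w} →
                          NonBacktracking (W ◅◅ W′) → NonBacktracking W′
    nonBacktracking-◅◅ʳ here       nb       = nb
    nonBacktracking-◅◅ʳ (step e W) (_ , nb) = nonBacktracking-◅◅ʳ W nb

    module _ (loopless : ∀ u → E u u ≡ false) where

      len≢1 : (C : Walk E x x) → len C ≢ 1
      len≢1 (step {u = u} e here) _ with () ← trans (sym e) (loopless u)

      module _ (acyclic : Acyclic E) where

        ¬nonBacktrackingSimpleLoop : (C : Walk E x x) → Unique (stops C) →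
                                     NonBacktracking C → 0 < len C → ⊥
        ¬nonBacktrackingSimpleLoop (step e here)           _    _         _ = len≢1 (step e here) refl
        ¬nonBacktrackingSimpleLoop (step e (step e′ here)) _    (x≢x , _) _ = x≢x refl
        ¬nonBacktrackingSimpleLoop C@(step _ (step _ (step _ _))) uniq _ _ =
          acyclic (stops C) (simpleLoop⇒cycle C uniq (s≤s (s≤s (s≤s z≤n))))

        ¬nonBacktrackingLoop : (C : Walk E x y) → x ≡ y → NonBacktracking C → 0 < len C → ⊥
        ¬nonBacktrackingLoop C refl nb nonempty with unique⊎simpleLoop C
        ... | inj₁ uniq = ¬nonBacktrackingSimpleLoop C uniq nb nonempty
        ... | inj₂ L    = ¬nonBacktrackingSimpleLoop (loop L) (simple L) nb-loop (loop-nonempty L)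
          where
          nb-loop : NonBacktracking (loop L)
          nb-loop = nonBacktracking-◅◅ˡ (loop L)
                      (nonBacktracking-◅◅ʳ (before L) (subst NonBacktracking (splits L) nb))

      oddSimpleLoop⇒shortOddCycle : (C : Walk E x x) → Unique (stops C) → parity (len C) ≡ 1ℙ →
                                    HasShortOddCycle E (len C)
      oddSimpleLoop⇒shortOddCycle (step e here) _ _ = ⊥-elim (len≢1 (step e here) refl)
      oddSimpleLoop⇒shortOddCycle C@(step _ (step _ (step _ _))) uniq odd =
        stops C , simpleLoop⇒cycle C uniq (s≤s (s≤s (s≤s z≤n))) ,
        parity≡1ℙ⇒%2≡1 (length (stops C)) (subst (λ m → parity m ≡ 1ℙ) (sym (length-stops C)) odd) ,
        ≤-reflexive (length-stops C)

      shortOddCycle-mono : ∀ {l m} → l ≤ m → HasShortOddCycle E l → HasShortOddCycle E m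
      shortOddCycle-mono l≤m (c , cycle , odd , c≤l) = c , cycle , odd , ≤-trans c≤l l≤m

      -- An odd closed walk splits at a repeated vertex into two closed walks, one of them odd.
      oddLoop⇒shortOddCycle : (C : Walk E x x) → parity (len C) ≡ 1ℙ → HasShortOddCycle E (len C)
      oddLoop⇒shortOddCycle C = go C (<-wellFounded (len C))
        where
        go : (C : Walk E x x) → Acc _<_ (len C) → parity (len C) ≡ 1ℙ → HasShortOddCycle E (len C)
        go C (acc shorter) odd with unique⊎simpleLoop C
        ... | inj₁ uniq = oddSimpleLoop⇒shortOddCycle C uniq odd
        ... | inj₂ L with parity-split (len (before L)) (len (loop L)) (len (after L))
                            (subst (λ m → parity m ≡ 1ℙ) (len-simpleLoopIn L) odd)
        ...   | inj₁ oddLoop = shortOddCycle-mono (len-loop≤ L)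
                                 (oddSimpleLoop⇒shortOddCycle (loop L) (simple L) oddLoop)
        ...   | inj₂ oddRest = shortOddCycle-mono (<⇒≤ (len-rest< L))
                                 (go (after L ◅◅ before L) (shorter (len-rest< L))
                                     (subst (λ m → parity m ≡ 1ℙ) (sym (len-◅◅ (after L) _)) oddRest))

    module _ {χ : Fin n → Parity} (proper : ∀ {u v} → Adj E u v → χ v ≡ χ u ⁻¹) where

      colour-walk : (W : Walk E u v) → χ v ≡ parity (len W) ⊕ χ u
      colour-walk here = refl
      colour-walk {v = v} (step {u = u} {v = u′} e W) = begin
        χ v                          ≡⟨ colour-walk W ⟩
        parity (len W) ⊕ χ u′        ≡⟨ cong (parity (len W) ⊕_) (proper e) ⟩
        parity (len W) ⊕ χ u ⁻¹      ≡⟨ ⊕-⁻¹-swap (parity (len W)) (χ u) ⟩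
        parity (len W) ⁻¹ ⊕ χ u      ≡⟨ cong (_⊕ χ u) (sym (parity-suc (len W))) ⟩
        parity (suc (len W)) ⊕ χ u   ∎
        where open ≡-Reasoning

  module _ {n} {E : Fin n → Fin n → Bool} {x y : Fin n} where

    addEdge-⊇ : ∀ {u v} → Adj E u v → Adj (addEdge E x y) u v
    addEdge-⊇ e rewrite e = refl

    addEdge-new : Adj (addEdge E x y) y x
    addEdge-new with y ≟ y | x ≟ x
    ... | yes _ | yes _ = trans (cong (E y x ∨_) (∨-zeroʳ _)) (∨-zeroʳ _)
    ... | no y≢y | _    = ⊥-elim (y≢y refl)
    ... | _ | no x≢x    = ⊥-elim (x≢x refl)

    addEdge-loopless : x ≢ y → (∀ u → E u u ≡ false) → ∀ u → addEdge E x y u u ≡ false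
    addEdge-loopless x≢y loopless u rewrite loopless u with u ≟ x | u ≟ y
    ... | yes refl | yes refl = ⊥-elim (x≢y refl)
    ... | yes _    | no _     = refl
    ... | no _     | yes _    = refl
    ... | no _     | no _     = refl

module BreadthFirstSearch where

  open import Defs hiding (sym)
  open Walks
  open import Data.Bool using (Bool; true)
  import Data.Bool.Properties as Bool
  open import Data.Empty using (⊥-elim)
  open import Data.Fin using (Fin; _≟_)
  open import Data.Fin.Properties using (any?)
  open import Data.Nat using (ℕ; zero; suc; _+_; _≤_; _<_; s≤s)
  open import Data.Nat.Properties
    using (≤-refl; ≤-pred; n≤0⇒n≡0; ≮⇒≥; ≤-antisym; +-suc; +-identityʳ)
  open import Data.Product using (_×_; _,_; ∃-syntax; proj₁; proj₂)
  open import Data.Sum using (_⊎_; inj₁; inj₂)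
  open import Relation.Binary.PropositionalEquality
  open import Relation.Nullary using (¬_; Dec; yes; no; _×-dec_; _⊎-dec_)

  least : (P : ℕ → Set) → (∀ d → Dec (P d)) → ∀ m → P m →
          ∃[ d ] (P d × ∀ {e} → e < d → ¬ P e)
  least P P? zero p = 0 , p , λ ()
  least P P? (suc m) p with P? 0
  ... | yes p₀ = 0 , p₀ , λ ()
  ... | no ¬p₀ with least (λ d → P (suc d)) (λ d → P? (suc d)) m p
  ...   | d , pd , below = suc d , pd , λ { {zero} _ → ¬p₀ ; {suc e} e<d → below (≤-pred e<d) }

  module BreadthFirst {n} (T : Fin n → Fin n → Bool) (a b : Fin n) (reachable : ∀ v → Walk T a v) where

    Reach : ℕ → Fin n → Set
    Reach zero    v = v ≡ a ⊎ v ≡ b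
    Reach (suc d) v = Reach d v ⊎ ∃[ u ] (Reach d u × Adj T u v)

    reach? : ∀ d v → Dec (Reach d v)
    reach? zero    v = (v ≟ a) ⊎-dec (v ≟ b)
    reach? (suc d) v = reach? d v ⊎-dec any? (λ u → reach? d u ×-dec (T u v Bool.≟ true))

    reach-walk : ∀ {d u v} (W : Walk T u v) → Reach d u → Reach (d + len W) v
    reach-walk {d} {v = v} here       r = subst (λ e → Reach e v) (sym (+-identityʳ d)) r
    reach-walk {d} {v = v} (step e W) r =
      subst (λ e → Reach e v) (sym (+-suc d (len W))) (reach-walk {suc d} W (inj₂ (_ , r , e)))

    private
      depthWitness : ∀ v → ∃[ d ] (Reach d v × ∀ {e} → e < d → ¬ Reach e v)
      depthWitness v =
        least (λ d → Reach d v) (λ d → reach? d v) _ (reach-walk {0} (reachable v) (inj₁ refl))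

    depth : Fin n → ℕ
    depth v = proj₁ (depthWitness v)

    reach-depth : ∀ v → Reach (depth v) v
    reach-depth v = proj₁ (proj₂ (depthWitness v))

    depth-least : ∀ {d v} → Reach d v → depth v ≤ d
    depth-least {v = v} r = ≮⇒≥ (λ d<depth → proj₂ (proj₂ (depthWitness v)) d<depth r)

    -- A root is its own parent.
    parent : Fin n → Fin n
    parent v with depthWitness v
    ... | suc d , inj₂ (u , _ , _) , _ = u
    ... | _ = v

    parent-spec : ∀ v {d} → depth v ≡ suc d → Adj T (parent v) v × depth (parent v) ≡ d
    parent-spec v eq with depthWitness v
    parent-spec v refl | suc d , inj₁ r , below = ⊥-elim (below ≤-refl r)
    parent-spec v refl | suc d , inj₂ (u , r , e) , below =
      e , ≤-antisym (depth-least r)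
                    (≮⇒≥ λ depth<d → below (s≤s depth<d) (inj₂ (u , reach-depth u , e)))

    depth-zero : ∀ {v} → depth v ≡ 0 → v ≡ a ⊎ v ≡ b
    depth-zero {v} eq = subst (λ d → Reach d v) eq (reach-depth v)

    depth-a : depth a ≡ 0
    depth-a = n≤0⇒n≡0 (depth-least {0} (inj₁ refl))

    depth-b : depth b ≡ 0
    depth-b = n≤0⇒n≡0 (depth-least {0} (inj₂ refl))

module Trees where

  open import Defs hiding (sym)
  open Walks
  open BreadthFirstSearch
  open import Data.Bool using (Bool; true; false; if_then_else_)
  open import Data.Empty using (⊥; ⊥-elim)
  open import Data.Fin using (Fin; _≟_)
  open import Data.Nat as ℕ using (ℕ; zero; suc; _+_; _*_; _∸_; _≤_; _<_; z≤n; s≤s; _%_)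
  open import Data.Nat.DivMod using (%-distribˡ-+; m<n⇒m%n≡m; m%n<n; n%1≡0; n%n≡0; [m+n]%n≡m%n)
  open import Data.Nat.Properties
    using (≤-refl; ≤-trans; <-trans; <-irrefl; ≤-pred; n≤1+n; n<1+n; n≤0⇒n≡0; ≤-total; ≤∧≢⇒<;
           +-mono-≤; +-suc; +-assoc; m∸n+n≡m; +-∸-assoc; ∸-monoˡ-≤; m≤n⇒m<n∨m≡n)
  import Data.Nat.Properties
  open import Data.Nat.Tactic.RingSolver using (solve-∀)
  open import Data.Nat.Base using (parity)
  open import Data.Parity using (Parity; 0ℙ; 1ℙ; _⁻¹) renaming (_+_ to _⊕_)
  open import Data.Parity.Properties
    using (⁻¹-selfInverse; +-homo-+; *-homo-*) renaming (+-cancelʳ-≡ to ⊕-cancelʳ-≡)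
  open import Data.Product using (Σ; _×_; _,_; ∃-syntax; proj₁; proj₂)
  open import Data.Sum using (_⊎_; inj₁; inj₂)
  open import Data.Unit using (tt)
  open import Function using (_∘′_)
  open import Relation.Binary.PropositionalEquality
  open import Relation.Nullary using (¬_; Dec; yes; no; _×-dec_; _⊎-dec_)
  open import Relation.Nullary.Decidable using (⌊_⌋)

  [1+m]%n≡1+m%n : ∀ m k → suc m % suc k ≢ 0 → suc m % suc k ≡ suc (m % suc k)
  [1+m]%n≡1+m%n m zero    ≢0 = ⊥-elim (≢0 (n%1≡0 (suc m)))
  [1+m]%n≡1+m%n m (suc k) ≢0 with suc (m % suc (suc k)) ℕ.≟ suc (suc k)
  ... | yes full   = ⊥-elim (≢0 (trans (%-distribˡ-+ 1 m (suc (suc k)))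
                                 (trans (cong (_% suc (suc k)) full) (n%n≡0 (suc (suc k))))))
  ... | no partial = trans (%-distribˡ-+ 1 m (suc (suc k)))
                           (m<n⇒m%n≡m (≤∧≢⇒< (m%n<n m (suc (suc k))) partial))

  [1+d+k∸r]%n≡0⇒d%n≡r : ∀ d k {r} → r ≤ k → (suc d + (k ∸ r)) % suc k ≡ 0 → d % suc k ≡ r
  [1+d+k∸r]%n≡0⇒d%n≡r d k {r} r≤k ≡0 = begin
    d % K                           ≡⟨ sym ([m+n]%n≡m%n d K) ⟩
    (d + K) % K                     ≡⟨ cong (λ m → (d + m) % K) (sym (m∸n+n≡m r≤K)) ⟩
    (d + (K ∸ r + r)) % K           ≡⟨ cong (_% K) (sym (+-assoc d (K ∸ r) r)) ⟩
    (d + (K ∸ r) + r) % K           ≡⟨ %-distribˡ-+ (d + (K ∸ r)) r K ⟩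
    ((d + (K ∸ r)) % K + r % K) % K ≡⟨ cong (λ m → (m + r % K) % K) shifted≡0 ⟩
    (r % K) % K                     ≡⟨ cong (_% K) r%K ⟩
    r % K                           ≡⟨ r%K ⟩
    r                               ∎
    where
    open ≡-Reasoning
    K = suc k
    r≤K = ≤-trans r≤k (n≤1+n k)
    r%K = m<n⇒m%n≡m (s≤s r≤k)
    shifted≡0 : (d + (K ∸ r)) % K ≡ 0
    shifted≡0 = trans (cong (λ m → (d + m) % K) (+-∸-assoc 1 r≤k))
                      (trans (cong (_% K) (+-suc d (k ∸ r))) ≡0)

  odd≤2k⇒≤2k∸1 : ∀ {m} k → parity m ≡ 1ℙ → m ≤ 2 * k → m ≤ 2 * k ∸ 1
  odd≤2k⇒≤2k∸1 {m} k odd m≤2k with m≤n⇒m<n∨m≡n m≤2k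
  ... | inj₁ m<2k = ∸-monoˡ-≤ 1 m<2k
  ... | inj₂ refl with () ← trans (sym odd) (*-homo-* 2 k)

  module RootedTree {n} (T : Graph n) (acyclic : Acyclic (adj T)) (connected : Connected (adj T))
                    {a b : Fin n} (ab : Adj (adj T) a b) where

    open BreadthFirst (adj T) a b (connected a) public

    private
      variable
        u v w x y : Fin n
        d : ℕ

    flip : Adj (adj T) u v → Adj (adj T) v u
    flip {u} {v} e = trans (Graph.sym T v u) e

    adj⇒≢ : Adj (adj T) u v → u ≢ v
    adj⇒≢ {u} e refl with () ← trans (sym e) (Graph.irrefl T u)

    depth<⇒≢ : depth u < depth v → u ≢ v
    depth<⇒≢ lt refl = <-irrefl refl lt

    module _ (eq : depth v ≡ suc d) where

      parent-adj : Adj (adj T) v (parent v)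
      parent-adj = flip (proj₁ (parent-spec v eq))

      depth-parent : depth (parent v) ≡ d
      depth-parent = proj₂ (parent-spec v eq)

    module Climb (stop : ℕ → Bool) where

      top : ℕ → Fin n → Fin n
      top zero    v = v
      top (suc d) v = if stop d then v else top d (parent v)

      climb : ∀ d v → depth v ≡ d → Walk (adj T) v (top d v)
      climb zero    v _  = here
      climb (suc d) v eq with stop d
      ... | true  = here
      ... | false = step (parent-adj eq) (climb d (parent v) (depth-parent eq))

      climb-noStepTo : ∀ d v (eq : depth v ≡ d) → d ≤ depth x → NoStepTo x (climb d v eq)
      climb-noStepTo zero    v eq _     = tt
      climb-noStepTo (suc d) v eq d<x with stop d
      ... | true  = tt
      ... | false = depth<⇒≢ (subst (_< _) (sym (depth-parent eq)) d<x) ∘′ sym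

      climb-nonBacktracking : ∀ d v (eq : depth v ≡ d) → NonBacktracking (climb d v eq)
      climb-nonBacktracking zero    v eq = tt
      climb-nonBacktracking (suc d) v eq with stop d
      ... | true  = tt
      ... | false = climb-noStepTo d (parent v) _ (subst (d ≤_) (sym eq) (n≤1+n d))
                  , climb-nonBacktracking d (parent v) (depth-parent eq)

    open Climb (λ _ → false) using ()
      renaming (top to rootFrom; climb to climbToRoot; climb-noStepTo to climbToRoot-noStepTo;
                climb-nonBacktracking to climbToRoot-nonBacktracking)

    root : Fin n → Fin n
    root v = rootFrom (depth v) v

    depth-rootFrom : ∀ d v → depth v ≡ d → depth (rootFrom d v) ≡ 0
    depth-rootFrom zero    v eq = eq
    depth-rootFrom (suc d) v eq = depth-rootFrom d (parent v) (depth-parent eq)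

    descend : ∀ d v → depth v ≡ d → Walk (adj T) v w → Walk (adj T) (rootFrom d v) w
    descend zero    v _  W = W
    descend (suc d) v eq W = descend d (parent v) (depth-parent eq) (step (flip (parent-adj eq)) W)

    descend-nonempty : ∀ d v (eq : depth v ≡ d) (W : Walk (adj T) v w) → 0 < len W →
                       0 < len (descend d v eq W)
    descend-nonempty zero    v eq W nonempty = nonempty
    descend-nonempty (suc d) v eq W _        = descend-nonempty d _ _ _ (s≤s z≤n)

    descend-nonBacktracking : ∀ d v (eq : depth v ≡ d) (W : Walk (adj T) v w) → NonBacktracking W →
                              (0 < d → NoStepTo (parent v) W) → NonBacktracking (descend d v eq W)
    descend-nonBacktracking zero    v eq W nb _  = nb
    descend-nonBacktracking (suc d) v eq W nb ns =
      descend-nonBacktracking d (parent v) (depth-parent eq) _ (ns (s≤s z≤n) , nb) grandparent≢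
      where
      grandparent≢ : 0 < d → parent (parent v) ≢ v
      grandparent≢ (s≤s z≤n) = depth<⇒≢ (subst₂ _<_ (sym (depth-parent (depth-parent eq))) (sym eq)
                                           (<-trans (n<1+n _) (n<1+n _)))

    descend-noStepTo : ∀ d v (eq : depth v ≡ d) (W : Walk (adj T) v w) →
                       depth x ≡ 0 → 0 < d → NoStepTo x (descend d v eq W)
    descend-noStepTo (suc zero)    v eq W x₀ _ = depth<⇒≢ (subst₂ _<_ (sym x₀) (sym eq) (s≤s z≤n))
    descend-noStepTo (suc (suc d)) v eq W x₀ _ = descend-noStepTo (suc d) _ _ _ x₀ (s≤s z≤n)

    IsRootEdge : Fin n → Fin n → Set
    IsRootEdge u v = (u ≡ a × v ≡ b) ⊎ (u ≡ b × v ≡ a)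

    isRootEdge? : ∀ u v → Dec (IsRootEdge u v)
    isRootEdge? u v = (u ≟ a ×-dec v ≟ b) ⊎-dec (u ≟ b ×-dec v ≟ a)

    depth≡0⇒rootEdge : depth u ≡ 0 → depth v ≡ 0 → u ≢ v → IsRootEdge u v
    depth≡0⇒rootEdge u₀ v₀ u≢v with depth-zero u₀ | depth-zero v₀
    ... | inj₁ refl | inj₁ refl = ⊥-elim (u≢v refl)
    ... | inj₁ refl | inj₂ refl = inj₁ (refl , refl)
    ... | inj₂ refl | inj₁ refl = inj₂ (refl , refl)
    ... | inj₂ refl | inj₂ refl = ⊥-elim (u≢v refl)

    rootEdge-adj : IsRootEdge u v → Adj (adj T) u v
    rootEdge-adj (inj₁ (refl , refl)) = ab
    rootEdge-adj (inj₂ (refl , refl)) = flip ab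

    ParentOf : Fin n → Fin n → Set
    ParentOf u v = ∃[ d ] (depth v ≡ suc d × parent v ≡ u)

    -- Down from the root of v to v, across to u, up to the root of u and, if the two roots
    -- differ, across the root edge: a closed walk without backtracking.
    nonParentTreeEdge⇒⊥ : Adj (adj T) u v → depth u ≤ depth v → depth v ≡ suc d → parent v ≢ u → ⊥
    nonParentTreeEdge⇒⊥ {u} {v} {d} uv u≤v v-depth pv≢u = close (rootFrom (suc d) v ≟ root u)
      where
      W₀ = step (flip uv) (climbToRoot (depth u) u refl)
      W₁ = descend (suc d) v v-depth W₀
      nb₁ = descend-nonBacktracking (suc d) v v-depth W₀
              (climbToRoot-noStepTo _ u refl u≤v , climbToRoot-nonBacktracking _ u refl) (λ _ → pv≢u)
      root₀ = depth-rootFrom (depth u) u refl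

      close : Dec (rootFrom (suc d) v ≡ root u) → ⊥
      close (yes same)  = ¬nonBacktrackingLoop (Graph.irrefl T) acyclic W₁ same nb₁
                            (descend-nonempty (suc d) v v-depth W₀ (s≤s z≤n))
      close (no differ) = ¬nonBacktrackingLoop (Graph.irrefl T) acyclic (step crossing W₁) refl
                            (descend-noStepTo _ v v-depth W₀ root₀ (s≤s z≤n) , nb₁) (s≤s z≤n)
        where
        crossing = rootEdge-adj (depth≡0⇒rootEdge root₀ (depth-rootFrom (suc d) v v-depth) (differ ∘′ sym))

    treeEdge⇒parentOf : Adj (adj T) u v → depth u ≤ depth v → ¬ IsRootEdge u v → ParentOf u v
    treeEdge⇒parentOf {u} {v} uv u≤v notRoot = byDepth (depth v) refl
      where
      byDepth : ∀ e → depth v ≡ e → ParentOf u v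
      byDepth zero    v₀ =
        ⊥-elim (notRoot (depth≡0⇒rootEdge (n≤0⇒n≡0 (subst (_ ≤_) v₀ u≤v)) v₀ (adj⇒≢ uv)))
      byDepth (suc d) v-depth with parent v ≟ u
      ... | yes pv≡u = d , v-depth , pv≡u
      ... | no  pv≢u = ⊥-elim (nonParentTreeEdge⇒⊥ uv u≤v v-depth pv≢u)

    treeEdge⇒parent : Adj (adj T) u v → ¬ IsRootEdge u v → ParentOf u v ⊎ ParentOf v u
    treeEdge⇒parent {u} {v} uv notRoot with ≤-total (depth u) (depth v)
    ... | inj₁ u≤v = inj₁ (treeEdge⇒parentOf uv u≤v notRoot)
    ... | inj₂ v≤u = inj₂ (treeEdge⇒parentOf (flip uv) v≤u (notRoot ∘′ swap))
      where
      swap : IsRootEdge v u → IsRootEdge u v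
      swap (inj₁ (p , q)) = inj₂ (q , p)
      swap (inj₂ (p , q)) = inj₁ (q , p)

    colourFrom : ℕ → Fin n → Parity
    colourFrom zero    v = if ⌊ v ≟ a ⌋ then 0ℙ else 1ℙ
    colourFrom (suc d) v = colourFrom d (parent v) ⁻¹

    colour : Fin n → Parity
    colour v = colourFrom (depth v) v

    colour-parent : depth v ≡ suc d → colour v ≡ colour (parent v) ⁻¹
    colour-parent {v} eq = trans (cong (λ e → colourFrom e v) eq)
                                 (cong (λ e → colourFrom e (parent v) ⁻¹) (sym (depth-parent eq)))

    colour-a : colour a ≡ 0ℙ
    colour-a = trans (cong (λ e → colourFrom e a) depth-a) root-colour
      where
      root-colour : colourFrom 0 a ≡ 0ℙ
      root-colour with a ≟ a
      ... | yes _   = refl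
      ... | no a≢a = ⊥-elim (a≢a refl)

    colour-b : colour b ≡ 1ℙ
    colour-b = trans (cong (λ e → colourFrom e b) depth-b) root-colour
      where
      root-colour : colourFrom 0 b ≡ 1ℙ
      root-colour with b ≟ a
      ... | yes b≡a = ⊥-elim (adj⇒≢ ab (sym b≡a))
      ... | no _    = refl

    colour-proper : Adj (adj T) u v → colour v ≡ colour u ⁻¹
    colour-proper {u} {v} uv with isRootEdge? u v
    ... | yes (inj₁ (refl , refl)) = trans colour-b (cong _⁻¹ (sym colour-a))
    ... | yes (inj₂ (refl , refl)) = trans colour-a (cong _⁻¹ (sym colour-b))
    ... | no notRoot with treeEdge⇒parent uv notRoot
    ...   | inj₁ (_ , eq , refl) = colour-parent eq
    ...   | inj₂ (_ , eq , refl) = sym (⁻¹-selfInverse (sym (colour-parent eq)))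

    module Rounds (k r : ℕ) where

      -- In round r the tree is cut below every level d ≡ r (mod k + 1).
      cutBelow : ℕ → Bool
      cutBelow d = ⌊ d % suc k ℕ.≟ r ⌋

      open Climb cutBelow

      anchor : Fin n → Fin n
      anchor v = top (depth v) v

      glueRoots : Fin n → Fin n
      glueRoots t = if ⌊ t ≟ b ⌋ then a else t

      block : Fin n → Fin n
      block v = glueRoots (anchor v)

      block-a : block a ≡ a
      block-a rewrite depth-a with a ≟ b
      ... | yes _ = refl
      ... | no _  = refl

      block-b : block b ≡ a
      block-b rewrite depth-b with b ≟ b
      ... | yes _   = refl
      ... | no b≢b = ⊥-elim (b≢b refl)

      block-parent : depth v ≡ suc d → d % suc k ≢ r → block v ≡ block (parent v)
      block-parent {v} {d} eq uncut rewrite eq | depth-parent eq with d % suc k ℕ.≟ r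
      ... | yes cut = ⊥-elim (uncut cut)
      ... | no _    = refl

      glueRoots-walk : ∀ {s t} → glueRoots s ≡ glueRoots t → Σ (Walk (adj T) s t) λ W → len W ≤ 1
      glueRoots-walk {s} {t} eq with s ≟ b | t ≟ b
      glueRoots-walk refl | yes refl | yes refl = here , z≤n
      glueRoots-walk refl | yes refl | no _     = step (flip ab) here , s≤s z≤n
      glueRoots-walk refl | no _     | yes refl = step ab here , s≤s z≤n
      glueRoots-walk refl | no _     | no _     = here , z≤n

      module _ (r≤k : r ≤ k) where

        -- (d + k - r) mod (k + 1) is the distance from level d up to the nearest level ≡ r + 1.
        climb-len : ∀ d v (eq : depth v ≡ d) → len (climb d v eq) ≤ (d + (k ∸ r)) % suc k
        climb-len zero    v eq = z≤n
        climb-len (suc d) v eq with d % suc k ℕ.≟ r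
        ... | yes _   = z≤n
        ... | no uncut = begin
          suc (len (climb d (parent v) (depth-parent eq))) ≤⟨ s≤s (climb-len d (parent v) (depth-parent eq)) ⟩
          suc ((d + (k ∸ r)) % suc k)
            ≡⟨ sym ([1+m]%n≡1+m%n (d + (k ∸ r)) k (uncut ∘′ [1+d+k∸r]%n≡0⇒d%n≡r d k r≤k)) ⟩
          (suc d + (k ∸ r)) % suc k                        ∎
          where open Data.Nat.Properties.≤-Reasoning

        toAnchor : ∀ v → Σ (Walk (adj T) v (anchor v)) λ W → len W ≤ k
        toAnchor v = climb (depth v) v refl
                   , ≤-pred (≤-trans (s≤s (climb-len (depth v) v refl)) (m%n<n (depth v + (k ∸ r)) (suc k)))

        sameBlock⇒walk : block x ≡ block y → Σ (Walk (adj T) x y) λ W → len W ≤ suc (k + k)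
        sameBlock⇒walk {x} {y} same = Wx ◅◅ Wab ◅◅ reverse flip Wy , bound
          where
          Wx = proj₁ (toAnchor x)
          Wy = proj₁ (toAnchor y)
          Wab = proj₁ (glueRoots-walk same)
          bound : len (Wx ◅◅ Wab ◅◅ reverse flip Wy) ≤ suc (k + k)
          bound = begin
            len (Wx ◅◅ Wab ◅◅ reverse flip Wy)         ≡⟨ len-◅◅ Wx _ ⟩
            len Wx + len (Wab ◅◅ reverse flip Wy)      ≡⟨ cong (len Wx +_) (len-◅◅ Wab _) ⟩
            len Wx + (len Wab + len (reverse flip Wy)) ≡⟨ cong (λ m → len Wx + (len Wab + m))
                                                               (len-reverse flip Wy) ⟩
            len Wx + (len Wab + len Wy)                ≤⟨ +-mono-≤ (proj₂ (toAnchor x)) (+-mono-≤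
                                                            (proj₂ (glueRoots-walk same)) (proj₂ (toAnchor y))) ⟩
            k + suc k                                  ≡⟨ +-suc k k ⟩
            suc (k + k)                                ∎
            where open Data.Nat.Properties.≤-Reasoning

        -- The walk from x to y through their block has even length, so closing it with xy is odd.
        sameBlock⇒shortOddCycle : x ≢ y → block x ≡ block y → colour x ≡ colour y →
                                  HasShortOddCycle (addEdge (adj T) x y) (2 * suc k ∸ 1)
        sameBlock⇒shortOddCycle {x} {y} x≢y same sameColour =
          shortOddCycle-mono loopless (odd≤2k⇒≤2k∸1 (suc k) odd len≤)
            (oddLoop⇒shortOddCycle loopless C odd)
          where
          loopless : ∀ u → addEdge (adj T) x y u u ≡ false
          loopless = addEdge-loopless {E = adj T} x≢y (Graph.irrefl T)
          W : Walk (adj T) x y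
          W = proj₁ (sameBlock⇒walk same)
          C : Walk (addEdge (adj T) x y) x x
          C = map (addEdge-⊇ {E = adj T}) W ◅◅ step (addEdge-new {E = adj T}) here
          len-C : len C ≡ len W + 1
          len-C = trans (len-◅◅ (map (addEdge-⊇ {E = adj T}) W) _) (cong (_+ 1) (len-map _ W))
          even : parity (len W) ≡ 0ℙ
          even = ⊕-cancelʳ-≡ (colour x) (parity (len W)) 0ℙ
                   (trans (sym (colour-walk colour-proper W)) (sym sameColour))
          odd : parity (len C) ≡ 1ℙ
          odd = trans (cong parity len-C) (trans (+-homo-+ (len W) 1) (cong (_⊕ 1ℙ) even))
          len≤ : len C ≤ 2 * suc k
          len≤ = subst (_≤ 2 * suc k) (sym len-C)
                   (subst (len W + 1 ≤_) (double k) (+-mono-≤ (proj₂ (sameBlock⇒walk same)) (≤-refl {1})))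
            where
            double : ∀ k → suc (k + k) + 1 ≡ 2 * suc k
            double = solve-∀

module Fractions where

  open import Defs using (coefA; coefB)
  import Data.Integer as ℤ
  import Data.Integer.Properties as ℤᵖ
  open import Data.Nat as ℕ using (ℕ; suc)
  open import Data.Nat.Properties using (+-comm; +-identityʳ)
  open import Data.Rational using (NonNegative; ℚ; 1ℚ; ½; _+_; _-_; _*_; _/_; toℚᵘ)
  open import Data.Rational.Properties
    using (toℚᵘ-injective; toℚᵘ-fromℚᵘ; toℚᵘ-homo-+; toℚᵘ-homo-*; normalize-nonNeg)
  open import Data.Rational.Solver using (module +-*-Solver)
  open import Data.Rational.Unnormalised using (mkℚᵘ; *≡*) renaming (_≃_ to _≃ᵘ_)
  import Data.Rational.Unnormalised.Properties as ᵘ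
  open import Relation.Binary.PropositionalEquality

  open +-*-Solver using (solve; _:+_; _:-_; _:*_; _:=_; con)

  ι : ℕ → ℚ
  ι m = ℤ.+ m / 1

  ι-nonNeg : ∀ m → NonNegative (ι m)
  ι-nonNeg m = normalize-nonNeg m 1

  private
    fraction : ∀ m d → toℚᵘ (ℤ.+ m / suc d) ≃ᵘ mkℚᵘ (ℤ.+ m) d
    fraction m d = toℚᵘ-fromℚᵘ (mkℚᵘ (ℤ.+ m) d)

  ι-+ : ∀ m n → ι (m ℕ.+ n) ≡ ι m + ι n
  ι-+ m n = toℚᵘ-injective (ᵘ.≃-trans (fraction (m ℕ.+ n) 0) (ᵘ.≃-sym
    (ᵘ.≃-trans (toℚᵘ-homo-+ (ι m) (ι n))
               (ᵘ.≃-trans (ᵘ.+-cong (fraction m 0) (fraction n 0)) (*≡* cross)))))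
    where
    open ℤᵖ using (*-identityʳ)
    cross : (ℤ.+ m ℤ.* ℤ.+ 1 ℤ.+ ℤ.+ n ℤ.* ℤ.+ 1) ℤ.* ℤ.+ 1 ≡ ℤ.+ (m ℕ.+ n) ℤ.* ℤ.+ 1
    cross = trans (*-identityʳ _) (trans (cong₂ ℤ._+_ (*-identityʳ (ℤ.+ m)) (*-identityʳ (ℤ.+ n)))
                                        (sym (trans (*-identityʳ _) (ℤᵖ.pos-+ m n))))

  ι-suc : ∀ m → ι (suc m) ≡ ι m + 1ℚ
  ι-suc m = trans (cong ι (+-comm 1 m)) (ι-+ m 1)

  ι-suc-* : ∀ m c → ι (suc m) * c ≡ ι m * c + c
  ι-suc-* m c = trans (cong (_* c) (ι-suc m)) (distrib (ι m) c)
    where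
    distrib : ∀ x c → (x + 1ℚ) * c ≡ x * c + c
    distrib = solve 2 (λ x c → (x :+ con 1ℚ) :* c := x :* c :+ c) refl

  ι-/ : ∀ m d → ℤ.+ m / suc d ≡ ι m * (ℤ.+ 1 / suc d)
  ι-/ m d = toℚᵘ-injective (ᵘ.≃-trans (fraction m d) (ᵘ.≃-sym
    (ᵘ.≃-trans (toℚᵘ-homo-* (ι m) (ℤ.+ 1 / suc d))
               (ᵘ.≃-trans (ᵘ.*-cong (fraction m 0) (fraction 1 d)) (*≡* cross)))))
    where
    cross : (ℤ.+ m ℤ.* ℤ.+ 1) ℤ.* ℤ.+ suc d ≡ ℤ.+ m ℤ.* ℤ.+ suc (d ℕ.+ 0)
    cross = trans (cong (ℤ._* ℤ.+ suc d) (ℤᵖ.*-identityʳ (ℤ.+ m)))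
                  (cong (λ e → ℤ.+ m ℤ.* ℤ.+ suc e) (sym (+-identityʳ d)))

  ι-inverse : ∀ d → ι (suc d) * (ℤ.+ 1 / suc d) ≡ 1ℚ
  ι-inverse d = toℚᵘ-injective (ᵘ.≃-trans (toℚᵘ-homo-* (ι (suc d)) (ℤ.+ 1 / suc d))
    (ᵘ.≃-trans (ᵘ.*-cong (fraction (suc d) 0) (fraction 1 d)) (*≡* cross)))
    where
    cross : (ℤ.+ suc d ℤ.* ℤ.+ 1) ℤ.* ℤ.+ 1 ≡ ℤ.+ 1 ℤ.* ℤ.+ suc (d ℕ.+ 0)
    cross = trans (ℤᵖ.*-identityʳ _) (trans (ℤᵖ.*-identityʳ _)
              (sym (trans (ℤᵖ.*-identityˡ _) (cong (λ e → ℤ.+ suc e) (+-identityʳ d)))))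

  -- Both identities reduce to 2(x + 1)c = 1 for x = ι k and c = coefB (k + 1).
  module Coefficients (k : ℕ) where

    private
      x = ι k
      c = coefB (suc k)

      coefA≡ : coefA (suc k) ≡ x * c
      coefA≡ = ι-/ k (k ℕ.+ suc (k ℕ.+ 0))

      2[x+1]c≡1 : (x + 1ℚ + (x + 1ℚ)) * c ≡ 1ℚ
      2[x+1]c≡1 = begin
        (x + 1ℚ + (x + 1ℚ)) * c     ≡⟨ cong (λ y → (y + y) * c) (sym (ι-suc k)) ⟩
        (ι (suc k) + ι (suc k)) * c ≡⟨ cong (_* c) (sym (ι-+ (suc k) (suc k))) ⟩
        ι (suc k ℕ.+ suc k) * c     ≡⟨ cong (λ m → ι (suc k ℕ.+ m) * c) (sym (+-identityʳ (suc k))) ⟩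
        ι (2 ℕ.* suc k) * c         ≡⟨ ι-inverse (k ℕ.+ suc (k ℕ.+ 0)) ⟩
        1ℚ                          ∎
        where open ≡-Reasoning

    coefB-nonNeg : NonNegative (coefB (suc k))
    coefB-nonNeg = normalize-nonNeg 1 (2 ℕ.* suc k)

    coef-rootEdge : ½ + coefA (suc k) + coefB (suc k) ≡ 1ℚ
    coef-rootEdge = begin
      ½ + coefA (suc k) + c              ≡⟨ cong (λ a → ½ + a + c) coefA≡ ⟩
      ½ + x * c + c                      ≡⟨ regroup x c ⟩
      ½ + ½ * ((x + 1ℚ + (x + 1ℚ)) * c)  ≡⟨ cong (λ y → ½ + ½ * y) 2[x+1]c≡1 ⟩
      ½ + ½ * 1ℚ                         ≡⟨⟩
      1ℚ                                 ∎
      where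
      open ≡-Reasoning
      regroup : ∀ x c → ½ + x * c + c ≡ ½ + ½ * ((x + 1ℚ + (x + 1ℚ)) * c)
      regroup = solve 2 (λ x c → con ½ :+ x :* c :+ c
                              := con ½ :+ con ½ :* ((x :+ con 1ℚ :+ (x :+ con 1ℚ)) :* c)) refl

    coef-treeEdge : ι (suc k) * (½ + coefA (suc k)) ≡ ι (suc k) - ½
    coef-treeEdge = begin
      ι (suc k) * (½ + coefA (suc k))                         ≡⟨ cong₂ (λ y a → y * (½ + a)) (ι-suc k) coefA≡ ⟩
      (x + 1ℚ) * (½ + x * c)                                  ≡⟨ regroup x c ⟩
      (x + 1ℚ) - ½ + ½ * x * ((x + 1ℚ + (x + 1ℚ)) * c - 1ℚ) ≡⟨ cong (λ y → (x + 1ℚ) - ½ + ½ * x * (y - 1ℚ))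
                                                                     2[x+1]c≡1 ⟩
      (x + 1ℚ) - ½ + ½ * x * (1ℚ - 1ℚ)                       ≡⟨ cancel x ⟩
      (x + 1ℚ) - ½                                            ≡⟨ cong (_- ½) (sym (ι-suc k)) ⟩
      ι (suc k) - ½                                           ∎
      where
      open ≡-Reasoning
      regroup : ∀ x c → (x + 1ℚ) * (½ + x * c) ≡ (x + 1ℚ) - ½ + ½ * x * ((x + 1ℚ + (x + 1ℚ)) * c - 1ℚ)
      regroup = solve 2 (λ x c → (x :+ con 1ℚ) :* (con ½ :+ x :* c)
                              := (x :+ con 1ℚ) :- con ½
                                 :+ con ½ :* x :* ((x :+ con 1ℚ :+ (x :+ con 1ℚ)) :* c :- con 1ℚ)) refl
      cancel : ∀ x → (x + 1ℚ) - ½ + ½ * x * (1ℚ - 1ℚ) ≡ (x + 1ℚ) - ½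
      cancel = solve 1 (λ x → (x :+ con 1ℚ) :- con ½ :+ con ½ :* x :* (con 1ℚ :- con 1ℚ)
                           := (x :+ con 1ℚ) :- con ½) refl

module Sums where

  open Fractions using (ι; ι-suc-*)
  open import Data.Bool using (Bool; true; false)
  open import Data.Empty using (⊥-elim)
  open import Data.Fin using (Fin; zero; suc)
  open import Data.List using (List; []; _∷_; foldr; map; allFin)
  open import Data.List.Membership.Propositional using (_∈_)
  open import Data.List.Membership.Propositional.Properties using (∈-allFin)
  open import Data.List.Relation.Unary.Any using (here; there)
  open import Data.Nat as ℕ using (ℕ; zero; suc)
  open import Data.Nat.Properties using (n<1+n; m<n⇒m<1+n; <⇒≢; ≤∧≢⇒<; ≤-pred)
  open import Data.Product using (_×_; _,_; ∃-syntax)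
  open import Data.Rational using (ℚ; 0ℚ; ½; _+_; _-_; _*_; _≤_; _<_; _≤?_)
  open import Data.Rational.Properties
    using (≤-refl; ≤-reflexive; ≤-trans; <-irrefl; <-≤-trans; ≰⇒>; +-mono-≤; +-monoʳ-≤; +-monoˡ-≤;
           +-mono-<; +-identityˡ; +-identityʳ; *-zeroˡ; *-zeroʳ; *-identityˡ; *-distribˡ-+; *-monoʳ-<-pos;
           *-monoˡ-≤-nonNeg)
  open import Data.Rational.Solver using (module +-*-Solver)
  open import Function using (_∘′_)
  open import Relation.Binary.PropositionalEquality
  open import Relation.Nullary using (yes; no)

  open +-*-Solver using (solve; _:+_; _:-_; _:*_; _:=_; con)

  private
    variable
      A : Set

  ∑ : List A → (A → ℚ) → ℚ
  ∑ xs f = foldr _+_ 0ℚ (map f xs)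

  module _ {f g : A → ℚ} where

    ∑-cong : ∀ xs → (∀ x → f x ≡ g x) → ∑ xs f ≡ ∑ xs g
    ∑-cong []       _   = refl
    ∑-cong (x ∷ xs) f≡g = cong₂ _+_ (f≡g x) (∑-cong xs f≡g)

    ∑-mono-≤ : ∀ xs → (∀ x → f x ≤ g x) → ∑ xs f ≤ ∑ xs g
    ∑-mono-≤ []       _   = ≤-refl
    ∑-mono-≤ (x ∷ xs) f≤g = +-mono-≤ (f≤g x) (∑-mono-≤ xs f≤g)

    ∑-distrib-+ : ∀ xs → ∑ xs (λ x → f x + g x) ≡ ∑ xs f + ∑ xs g
    ∑-distrib-+ []       = refl
    ∑-distrib-+ (x ∷ xs) = trans (cong (f x + g x +_) (∑-distrib-+ xs))
                                 (interchange (f x) (g x) (∑ xs f) (∑ xs g))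
      where
      interchange : ∀ a b c d → a + b + (c + d) ≡ a + c + (b + d)
      interchange = solve 4 (λ a b c d → a :+ b :+ (c :+ d) := a :+ c :+ (b :+ d)) refl

  ∑-zero : ∀ (xs : List A) → ∑ xs (λ _ → 0ℚ) ≡ 0ℚ
  ∑-zero []       = refl
  ∑-zero (x ∷ xs) = cong (0ℚ +_) (∑-zero xs)

  ∑-*ˡ : ∀ (xs : List A) c f → ∑ xs (λ x → c * f x) ≡ c * ∑ xs f
  ∑-*ˡ []       c f = sym (*-zeroʳ c)
  ∑-*ˡ (x ∷ xs) c f = trans (cong (c * f x +_) (∑-*ˡ xs c f)) (sym (*-distribˡ-+ c (f x) (∑ xs f)))

  ∑-nonNeg : ∀ (xs : List A) {f} → (∀ x → 0ℚ ≤ f x) → 0ℚ ≤ ∑ xs f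
  ∑-nonNeg xs {f} 0≤f = subst (_≤ ∑ xs f) (∑-zero xs) (∑-mono-≤ xs 0≤f)

  ∑-≥-term : ∀ {xs : List A} {f y} → (∀ x → 0ℚ ≤ f x) → y ∈ xs → f y ≤ ∑ xs f
  ∑-≥-term {xs = x ∷ xs} {f} 0≤f (here refl) =
    subst (_≤ f x + ∑ xs f) (+-identityʳ (f x)) (+-monoʳ-≤ (f x) (∑-nonNeg xs 0≤f))
  ∑-≥-term {xs = x ∷ xs} {f} 0≤f (there y∈) =
    ≤-trans (∑-≥-term 0≤f y∈)
            (subst (_≤ f x + ∑ xs f) (+-identityˡ (∑ xs f)) (+-monoˡ-≤ (∑ xs f) (0≤f x)))

  module _ {n : ℕ} where

    Σ² : (Fin n → Fin n → ℚ) → ℚ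
    Σ² f = ∑ (allFin n) λ u → ∑ (allFin n) (f u)

    Σ²-cong : ∀ {f g : Fin n → Fin n → ℚ} → (∀ u v → f u v ≡ g u v) → Σ² f ≡ Σ² g
    Σ²-cong f≡g = ∑-cong (allFin n) λ u → ∑-cong (allFin n) (f≡g u)

    Σ²-mono-≤ : ∀ {f g : Fin n → Fin n → ℚ} → (∀ u v → f u v ≤ g u v) → Σ² f ≤ Σ² g
    Σ²-mono-≤ f≤g = ∑-mono-≤ (allFin n) λ u → ∑-mono-≤ (allFin n) (f≤g u)

    Σ²-distrib-+ : ∀ (f g : Fin n → Fin n → ℚ) → Σ² (λ u v → f u v + g u v) ≡ Σ² f + Σ² g
    Σ²-distrib-+ f g = trans (∑-cong (allFin n) λ u → ∑-distrib-+ (allFin n)) (∑-distrib-+ (allFin n))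

    Σ²-*ˡ : ∀ c (f : Fin n → Fin n → ℚ) → Σ² (λ u v → c * f u v) ≡ c * Σ² f
    Σ²-*ˡ c f = trans (∑-cong (allFin n) λ u → ∑-*ˡ (allFin n) c (f u)) (∑-*ˡ (allFin n) c _)

    Σ²-≥-term : ∀ {f : Fin n → Fin n → ℚ} → (∀ u v → 0ℚ ≤ f u v) → ∀ u v → f u v ≤ Σ² f
    Σ²-≥-term 0≤f u v = ≤-trans (∑-≥-term (0≤f u) (∈-allFin v))
                                 (∑-≥-term (λ u → ∑-nonNeg (allFin n) (0≤f u)) (∈-allFin u))

  ∑< : ℕ → (ℕ → ℚ) → ℚ
  ∑< zero    f = 0ℚ
  ∑< (suc K) f = ∑< K f + f K

  ∑<-cong : ∀ K {f g : ℕ → ℚ} → (∀ r → f r ≡ g r) → ∑< K f ≡ ∑< K g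
  ∑<-cong zero    _   = refl
  ∑<-cong (suc K) f≡g = cong₂ _+_ (∑<-cong K f≡g) (f≡g K)

  ∑<-∑ : ∀ K (xs : List A) (f : ℕ → A → ℚ) →
         ∑< K (λ r → ∑ xs (f r)) ≡ ∑ xs (λ x → ∑< K (λ r → f r x))
  ∑<-∑ zero    xs f = sym (∑-zero xs)
  ∑<-∑ (suc K) xs f = trans (cong (_+ ∑ xs (f K)) (∑<-∑ K xs f)) (sym (∑-distrib-+ xs))

  ∑<-Σ² : ∀ {n} K (f : ℕ → Fin n → Fin n → ℚ) →
          ∑< K (λ r → Σ² (f r)) ≡ Σ² (λ u v → ∑< K (λ r → f r u v))
  ∑<-Σ² {n} K f =
    trans (∑<-∑ K (allFin n) _) (∑-cong (allFin n) λ u → ∑<-∑ K (allFin n) (λ r → f r u))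

  ∑<-≥-const : ∀ K {f c} → (∀ r → r ℕ.< K → c ≤ f r) → ι K * c ≤ ∑< K f
  ∑<-≥-const zero    {c = c} _   = ≤-reflexive (*-zeroˡ c)
  ∑<-≥-const (suc K) {f} {c} c≤f = subst (_≤ ∑< (suc K) f) (sym (ι-suc-* K c))
    (+-mono-≤ (∑<-≥-const K (λ r r<K → c≤f r (m<n⇒m<1+n r<K))) (c≤f K (n<1+n K)))

  private
    last-spared : ∀ a c c′ → a + c - (c - c′) ≡ a + c′
    last-spared = solve 3 (λ a c c′ → a :+ c :- (c :- c′) := a :+ c′) refl

    earlier-spared : ∀ a c c′ → a + c - (c - c′) ≡ a - (c - c′) + c
    earlier-spared = solve 3 (λ a c c′ → a :+ c :- (c :- c′) := a :- (c :- c′) :+ c) refl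

  ∑<-≥-except : ∀ K {f c c′ r₀} → r₀ ℕ.< K → (∀ r → r ℕ.< K → r ≢ r₀ → c ≤ f r) → c′ ≤ f r₀ →
                ι K * c - (c - c′) ≤ ∑< K f
  ∑<-≥-except (suc K) {f} {c} {c′} {r₀} r₀<1+K c≤f c′≤f with K ℕ.≟ r₀
  ... | yes refl = subst (_≤ ∑< (suc K) f) (sym (trans (cong (_- (c - c′)) (ι-suc-* K c)) (last-spared (ι K * c) c c′)))
                     (+-mono-≤ (∑<-≥-const K λ r r<K → c≤f r (m<n⇒m<1+n r<K) (<⇒≢ r<K)) c′≤f)
  ... | no K≢r₀  = subst (_≤ ∑< (suc K) f) (sym (trans (cong (_- (c - c′)) (ι-suc-* K c)) (earlier-spared (ι K * c) c c′)))
                     (+-mono-≤ (∑<-≥-except K (≤∧≢⇒< (≤-pred r₀<1+K) (K≢r₀ ∘′ sym))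
                                               (λ r r<K → c≤f r (m<n⇒m<1+n r<K)) c′≤f)
                               (c≤f K (n<1+n K) K≢r₀))

  ∑<-average : ∀ K {f B} → ι (suc K) * B ≤ ∑< (suc K) f → ∃[ r ] (r ℕ.< suc K × B ≤ f r)
  ∑<-average zero    {f} {B} B≤ = 0 , n<1+n 0 , subst₂ _≤_ (*-identityˡ B) (+-identityˡ (f 0)) B≤
  ∑<-average (suc K) {f} {B} B≤ with B ≤? f (suc K)
  ... | yes B≤f = suc K , n<1+n (suc K) , B≤f
  ... | no  B≰f with ι (suc K) * B ≤? ∑< (suc K) f
  ...   | yes B≤∑ = let r , r<1+K , B≤fr = ∑<-average K B≤∑ in r , m<n⇒m<1+n r<1+K , B≤fr
  ...   | no  B≰∑ = ⊥-elim (<-irrefl refl (<-≤-trans (+-mono-< (≰⇒> B≰∑) (≰⇒> B≰f))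
                                                      (subst (_≤ _) (ι-suc-* (suc K) B) B≤)))

  extend : ∀ {n} → Bool → (Fin n → Bool) → Fin (suc n) → Bool
  extend β s zero    = β
  extend β s (suc i) = s i

  𝔼 : ∀ n → ((Fin n → Bool) → ℚ) → ℚ
  𝔼 zero    F = F (λ ())
  𝔼 (suc n) F = ½ * (𝔼 n (λ s → F (extend false s)) + 𝔼 n (λ s → F (extend true s)))

  private
    half-double : ∀ c → ½ * (c + c) ≡ c
    half-double = solve 1 (λ c → con ½ :* (c :+ c) := c) refl

  𝔼-cong : ∀ n {F G : (Fin n → Bool) → ℚ} → (∀ s → F s ≡ G s) → 𝔼 n F ≡ 𝔼 n G
  𝔼-cong zero    F≡G = F≡G _
  𝔼-cong (suc n) F≡G = cong (½ *_) (cong₂ _+_ (𝔼-cong n λ _ → F≡G _) (𝔼-cong n λ _ → F≡G _))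

  𝔼-mono-≤ : ∀ n {F G : (Fin n → Bool) → ℚ} → (∀ s → F s ≤ G s) → 𝔼 n F ≤ 𝔼 n G
  𝔼-mono-≤ zero    F≤G = F≤G _
  𝔼-mono-≤ (suc n) F≤G =
    *-monoˡ-≤-nonNeg ½ (+-mono-≤ (𝔼-mono-≤ n (λ s → F≤G _)) (𝔼-mono-≤ n (λ s → F≤G _)))

  𝔼-const : ∀ n c → 𝔼 n (λ _ → c) ≡ c
  𝔼-const zero    c = refl
  𝔼-const (suc n) c = trans (cong (½ *_) (cong₂ _+_ (𝔼-const n c) (𝔼-const n c))) (half-double c)

  𝔼-distrib-+ : ∀ n (F G : (Fin n → Bool) → ℚ) → 𝔼 n (λ s → F s + G s) ≡ 𝔼 n F + 𝔼 n G
  𝔼-distrib-+ zero    F G = refl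
  𝔼-distrib-+ (suc n) F G =
    trans (cong (½ *_) (cong₂ _+_ (𝔼-distrib-+ n (F ∘′ extend false) (G ∘′ extend false))
                                  (𝔼-distrib-+ n (F ∘′ extend true) (G ∘′ extend true))))
          (regroup (𝔼 n (F ∘′ extend false)) (𝔼 n (G ∘′ extend false))
                   (𝔼 n (F ∘′ extend true)) (𝔼 n (G ∘′ extend true)))
    where
    regroup : ∀ a b c d → ½ * (a + b + (c + d)) ≡ ½ * (a + c) + ½ * (b + d)
    regroup = solve 4 (λ a b c d → con ½ :* (a :+ b :+ (c :+ d)) := con ½ :* (a :+ c) :+ con ½ :* (b :+ d)) refl

  𝔼-∑ : ∀ n (xs : List A) (F : (Fin n → Bool) → A → ℚ) →
        𝔼 n (λ s → ∑ xs (F s)) ≡ ∑ xs (λ x → 𝔼 n (λ s → F s x))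
  𝔼-∑ n []       F = 𝔼-const n 0ℚ
  𝔼-∑ n (x ∷ xs) F =
    trans (𝔼-distrib-+ n (λ s → F s x) _) (cong (𝔼 n (λ s → F s x) +_) (𝔼-∑ n xs F))

  𝔼-average : ∀ n {F : (Fin n → Bool) → ℚ} {B} → B ≤ 𝔼 n F → ∃[ s ] B ≤ F s
  𝔼-average zero    B≤ = (λ ()) , B≤
  𝔼-average (suc n) {F} {B} B≤ with B ≤? 𝔼 n (F ∘′ extend false) | B ≤? 𝔼 n (F ∘′ extend true)
  ... | yes B≤₀ | _ = let s , B≤F = 𝔼-average n B≤₀ in extend false s , B≤F
  ... | no _ | yes B≤₁ = let s , B≤F = 𝔼-average n B≤₁ in extend true s , B≤F
  ... | no B≰₀ | no B≰₁ = ⊥-elim (<-irrefl refl (<-≤-trans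
        (subst (_ <_) (half-double B) (*-monoʳ-<-pos ½ (+-mono-< (≰⇒> B≰₀) (≰⇒> B≰₁)))) B≤))

  𝔼-coordinate : ∀ n (i : Fin n) (h : Bool → ℚ) → 𝔼 n (λ s → h (s i)) ≡ ½ * (h false + h true)
  𝔼-coordinate (suc n) zero    h = cong (½ *_) (cong₂ _+_ (𝔼-const n (h false)) (𝔼-const n (h true)))
  𝔼-coordinate (suc n) (suc i) h =
    trans (cong (½ *_) (cong₂ _+_ (𝔼-coordinate n i h) (𝔼-coordinate n i h))) (half-double _)

  𝔼-coordinates : ∀ n {i j : Fin n} → i ≢ j → (h : Bool → Bool → ℚ) →
                  𝔼 n (λ s → h (s i) (s j))
                  ≡ ½ * (½ * (h false false + h false true) + ½ * (h true false + h true true))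
  𝔼-coordinates (suc n) {zero}  {zero}  i≢j h = ⊥-elim (i≢j refl)
  𝔼-coordinates (suc n) {zero}  {suc j} i≢j h =
    cong (½ *_) (cong₂ _+_ (𝔼-coordinate n j (h false)) (𝔼-coordinate n j (h true)))
  𝔼-coordinates (suc n) {suc i} {zero}  i≢j h =
    trans (cong (½ *_) (cong₂ _+_ (𝔼-coordinate n i λ x → h x false) (𝔼-coordinate n i λ x → h x true)))
          (transpose (h false false) (h false true) (h true false) (h true true))
    where
    transpose : ∀ a b c d → ½ * (½ * (a + c) + ½ * (b + d)) ≡ ½ * (½ * (a + b) + ½ * (c + d))
    transpose = solve 4 (λ a b c d → con ½ :* (con ½ :* (a :+ c) :+ con ½ :* (b :+ d))
                                  := con ½ :* (con ½ :* (a :+ b) :+ con ½ :* (c :+ d))) refl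
  𝔼-coordinates (suc n) {suc i} {suc j} i≢j h =
    trans (cong (½ *_) (cong₂ _+_ (𝔼-coordinates n i≢j′ h) (𝔼-coordinates n i≢j′ h))) (half-double _)
    where
    i≢j′ = λ i≡j → i≢j (cong suc i≡j)

  𝔼-Σ² : ∀ {n} m (F : (Fin m → Bool) → Fin n → Fin n → ℚ) →
         𝔼 m (λ s → Σ² (F s)) ≡ Σ² (λ u v → 𝔼 m (λ s → F s u v))
  𝔼-Σ² {n} m F =
    trans (𝔼-∑ m (allFin n) _) (∑-cong (allFin n) λ u → 𝔼-∑ m (allFin n) (λ s → F s u))

module Cuts where

  open import Defs hiding (sym)
  open Walks
  open Trees
  open Fractions
  open Sums
  open import Data.Bool using (Bool; true; false; _∧_; _xor_; if_then_else_)
  open import Data.Bool.Properties using (∧-identityʳ; ¬-not)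
  import Data.Bool.Properties as Bool
  open import Data.Empty using (⊥-elim)
  open import Data.Fin using (Fin; toℕ) renaming (_≟_ to _≟ᶠ_)
  open import Data.Fin.Properties using (toℕ-injective)
  open import Data.Nat as ℕ using (ℕ; suc; _%_)
  open import Data.Nat.DivMod using (m%n<n)
  import Data.Nat.Properties as ℕᵖ
  open import Data.Parity using (Parity; 0ℙ; 1ℙ)
  import Data.Parity.Properties as ℙ
  open import Data.Product using (Σ; _,_; ∃-syntax; proj₁; proj₂)
  open import Data.Sum using (inj₁; inj₂)
  open import Data.Rational using (ℚ; 0ℚ; 1ℚ; ½; _+_; _-_; _*_; _≤_)
  open import Data.Rational.Properties
    using (≤-refl; ≤-reflexive; *-identityˡ; +-identityʳ; +-monoʳ-≤; *-monoˡ-≤-nonNeg;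
           module ≤-Reasoning)
  open import Data.Rational.Solver using (module +-*-Solver)
  open import Function using (_∘′_)
  open import Relation.Binary using (tri<; tri≈; tri>)
  open import Relation.Binary.PropositionalEquality
  open import Relation.Nullary using (¬_; Dec; yes; no)
  open import Relation.Nullary.Decidable using (⌊_⌋)

  open +-*-Solver using (solve; _:+_; _:-_; _:*_; _:=_; con)

  toBool : Parity → Bool
  toBool 0ℙ = false
  toBool 1ℙ = true

  toBool-≢ : ∀ {p q} → p ≢ q → toBool p xor toBool q ≡ true
  toBool-≢ {0ℙ} {0ℙ} p≢q = ⊥-elim (p≢q refl)
  toBool-≢ {0ℙ} {1ℙ} _   = refl
  toBool-≢ {1ℙ} {0ℙ} _   = refl
  toBool-≢ {1ℙ} {1ℙ} p≢q = ⊥-elim (p≢q refl)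

  xor-cancelʳ : ∀ x y z → (x xor z) xor (y xor z) ≡ x xor y
  xor-cancelʳ false false false = refl
  xor-cancelʳ false false true  = refl
  xor-cancelʳ false true  false = refl
  xor-cancelʳ false true  true  = refl
  xor-cancelʳ true  false false = refl
  xor-cancelʳ true  false true  = refl
  xor-cancelʳ true  true  false = refl
  xor-cancelʳ true  true  true  = refl

  half≤ : ∀ {x} → 0ℚ ≤ x → ½ * x ≤ x
  half≤ {x} 0≤x =
    subst₂ _≤_ (+-identityʳ (½ * x)) (halves x) (+-monoʳ-≤ (½ * x) (*-monoˡ-≤-nonNeg ½ 0≤x))
    where
    halves : ∀ x → ½ * x + ½ * x ≡ x
    halves = solve 1 (λ x → con ½ :* x :+ con ½ :* x := x) refl

  module _ {n} (G : Graph n) (w : Fin n → Fin n → ℚ) (A : Fin n → Bool) where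

    -- The cut test of cutWeight is local to it; matching on A u and A v exposes it as xor.
    private
      cutEdge : Σ (Fin n → Fin n → Bool) λ P → cutWeight G w A ≡ pairSum P w
      cutEdge = _ , refl

      cutEdge-xor : ∀ u v → proj₁ cutEdge u v ≡ adj G u v ∧ (A u xor A v)
      cutEdge-xor u v with A u | A v
      ... | true  | true  = refl
      ... | true  | false = refl
      ... | false | true  = refl
      ... | false | false = refl

    cutWeight-xor : cutWeight G w A ≡ pairSum (λ u v → adj G u v ∧ (A u xor A v)) w
    cutWeight-xor = trans (proj₂ cutEdge) (Σ²-cong λ u v →
      cong (λ x → if x ∧ ⌊ toℕ u ℕ.<? toℕ v ⌋ then w u v else 0ℚ) (cutEdge-xor u v))

  module CutAnalysis {n} (k : ℕ) (G : Graph n) (w : Fin n → Fin n → ℚ) (w-nonNeg : ∀ u v → 0ℚ ≤ w u v)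
                     (T : Graph n) (tree : SpanningTree G T) {a b : Fin n} (ab : Adj (adj T) a b)
                     (noShortOddCycle : ∀ x y → Adj (adj G) x y → adj T x y ≡ false →
                                        ¬ HasShortOddCycle (addEdge (adj T) x y) (2 ℕ.* suc k ℕ.∸ 1)) where

    open SpanningTree tree
    open RootedTree T acyclic connected ab
    open Coefficients k

    private
      K = suc k

    block : ℕ → Fin n → Fin n
    block r = Rounds.block k r

    side : ℕ → (Fin n → Bool) → Fin n → Bool
    side r s v = toBool (colour v) xor s (block r v)

    lt : Fin n → Fin n → Bool
    lt u v = ⌊ toℕ u ℕ.<? toℕ v ⌋

    term : (Fin n → Fin n → Bool) → Fin n → Fin n → ℚ
    term P u v = if P u v ∧ lt u v then w u v else 0ℚ

    crossing : ℕ → (Fin n → Bool) → Fin n → Fin n → ℚ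
    crossing r s u v = if (adj G u v ∧ (side r s u xor side r s v)) ∧ lt u v then w u v else 0ℚ

    gain : ℕ → Fin n → Fin n → ℚ
    gain r u v = 𝔼 n (λ s → crossing r s u v)

    rootEdgeᵇ : Fin n → Fin n → Bool
    rootEdgeᵇ u v = ⌊ isRootEdge? u v ⌋

    coef : Fin n → Fin n → ℚ
    coef u v = ½ * term (adj G) u v + coefA K * term (adj T) u v + coefB K * term rootEdgeᵇ u v

    private
      term≡w : ∀ P {u v} → P u v ≡ true → lt u v ≡ true → term P u v ≡ w u v
      term≡w P uv u<v rewrite uv | u<v = refl

      term≡0 : ∀ P {u v} → P u v ∧ lt u v ≡ false → term P u v ≡ 0ℚ
      term≡0 P uv rewrite uv = refl

      coef≡ : ∀ {u v x y z} → term (adj G) u v ≡ x → term (adj T) u v ≡ y →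
              term rootEdgeᵇ u v ≡ z → coef u v ≡ ½ * x + coefA K * y + coefB K * z
      coef≡ refl refl refl = refl

      ∧-⊆ : ∀ {x y} l → (x ≡ true → y ≡ true) → y ∧ l ≡ false → x ∧ l ≡ false
      ∧-⊆ {false} l _   _   = refl
      ∧-⊆ {true}  l x⇒y y∧l rewrite x⇒y refl = y∧l

      rootEdgeᵇ⇒adj : ∀ {u v} → rootEdgeᵇ u v ≡ true → Adj (adj T) u v
      rootEdgeᵇ⇒adj {u} {v} re with isRootEdge? u v
      ... | yes root = rootEdge-adj root

      colour-≢ : ∀ {u v} → Adj (adj T) u v → colour u ≢ colour v
      colour-≢ {u} uv same = ℙ.p≢p⁻¹ (colour u) (trans same (colour-proper uv))

    gain-nonNeg : ∀ r u v → 0ℚ ≤ gain r u v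
    gain-nonNeg r u v = subst (_≤ gain r u v) (𝔼-const n 0ℚ) (𝔼-mono-≤ n λ s → if-nonNeg _)
      where
      if-nonNeg : ∀ c → 0ℚ ≤ (if c then w u v else 0ℚ)
      if-nonNeg true  = w-nonNeg u v
      if-nonNeg false = ≤-refl

    nonEdge-bound : ∀ {u v} → adj G u v ∧ lt u v ≡ false → ι K * coef u v ≤ ∑< K (λ r → gain r u v)
    nonEdge-bound {u} {v} nonEdge = subst (_≤ ∑< K (λ r → gain r u v)) (cong (ι K *_) (sym coef≡0))
                                      (∑<-≥-const K λ r _ → gain-nonNeg r u v)
      where
      coef≡0 : coef u v ≡ 0ℚ
      coef≡0 = trans (coef≡ (term≡0 (adj G) nonEdge) (term≡0 (adj T) (∧-⊆ _ (subgraph u v) nonEdge))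
                            (term≡0 rootEdgeᵇ (∧-⊆ _ (subgraph u v ∘′ rootEdgeᵇ⇒adj) nonEdge)))
                     (zeros (coefA K) (coefB K))
        where
        zeros : ∀ a c → ½ * 0ℚ + a * 0ℚ + c * 0ℚ ≡ 0ℚ
        zeros = solve 2 (λ a c → con ½ :* con 0ℚ :+ a :* con 0ℚ :+ c :* con 0ℚ := con 0ℚ) refl

    module _ {u v} (uv : adj G u v ≡ true) (u<v : lt u v ≡ true) where

      private
        cu = toBool (colour u)
        cv = toBool (colour v)

      gain≡ : ∀ r → gain r u v ≡
              𝔼 n (λ s → if (cu xor s (block r u)) xor (cv xor s (block r v)) then w u v else 0ℚ)
      gain≡ r = 𝔼-cong n λ s → cong (λ x → if x then w u v else 0ℚ)
        (trans (cong₂ (λ g l → (g ∧ (side r s u xor side r s v)) ∧ l) uv u<v) (∧-identityʳ _))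

      gain-sameBlock : ∀ r → block r u ≡ block r v → colour u ≢ colour v → gain r u v ≡ w u v
      gain-sameBlock r same differ = begin
        gain r u v                                   ≡⟨ gain≡ r ⟩
        𝔼 n (λ s → if crosses s then w u v else 0ℚ) ≡⟨ 𝔼-cong n (λ s → cong (λ x → if x then w u v else 0ℚ)
                                                                       (coins-cancel s)) ⟩
        𝔼 n (λ _ → if cu xor cv then w u v else 0ℚ) ≡⟨ 𝔼-const n _ ⟩
        (if cu xor cv then w u v else 0ℚ)            ≡⟨ cong (λ x → if x then w u v else 0ℚ) (toBool-≢ differ) ⟩
        w u v                                        ∎
        where
        open ≡-Reasoning
        crosses : (Fin n → Bool) → Bool
        crosses s = (cu xor s (block r u)) xor (cv xor s (block r v))
        coins-cancel : ∀ s → crosses s ≡ cu xor cv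
        coins-cancel s = trans (cong (λ i → (cu xor s (block r u)) xor (cv xor s i)) (sym same))
                               (xor-cancelʳ cu cv _)

      gain-splitBlock : ∀ r → block r u ≢ block r v → gain r u v ≡ ½ * w u v
      gain-splitBlock r split =
        trans (gain≡ r) (trans (𝔼-coordinates n split (λ x y → if (cu xor x) xor (cv xor y) then w u v else 0ℚ))
                               (average cu cv))
        where
        quarters₁ : ∀ x → ½ * (½ * (0ℚ + x) + ½ * (x + 0ℚ)) ≡ ½ * x
        quarters₁ = solve 1 (λ x → con ½ :* (con ½ :* (con 0ℚ :+ x) :+ con ½ :* (x :+ con 0ℚ))
                                := con ½ :* x) refl
        quarters₂ : ∀ x → ½ * (½ * (x + 0ℚ) + ½ * (0ℚ + x)) ≡ ½ * x
        quarters₂ = solve 1 (λ x → con ½ :* (con ½ :* (x :+ con 0ℚ) :+ con ½ :* (con 0ℚ :+ x))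
                                := con ½ :* x) refl
        average : ∀ cu cv → let h x y = if (cu xor x) xor (cv xor y) then w u v else 0ℚ in
                  ½ * (½ * (h false false + h false true) + ½ * (h true false + h true true)) ≡ ½ * w u v
        average false false = quarters₁ (w u v)
        average false true  = quarters₂ (w u v)
        average true  false = quarters₂ (w u v)
        average true  true  = quarters₁ (w u v)

      gain-half : ∀ r → colour u ≢ colour v → ½ * w u v ≤ gain r u v
      gain-half r differ with block r u ≟ᶠ block r v
      ... | yes same  = subst (½ * w u v ≤_) (sym (gain-sameBlock r same differ)) (half≤ (w-nonNeg u v))
      ... | no  split = ≤-reflexive (sym (gain-splitBlock r split))

      rootEdge-bound : IsRootEdge u v → ι K * coef u v ≤ ∑< K (λ r → gain r u v)
      rootEdge-bound root = subst (_≤ ∑< K (λ r → gain r u v)) (cong (ι K *_) (sym coef≡w))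
        (∑<-≥-const K λ r _ →
          ≤-reflexive (sym (gain-sameBlock r (sameBlock root r) (colour-≢ (rootEdge-adj root)))))
        where
        sameBlock : IsRootEdge u v → ∀ r → block r u ≡ block r v
        sameBlock (inj₁ (refl , refl)) r = trans (Rounds.block-a k r) (sym (Rounds.block-b k r))
        sameBlock (inj₂ (refl , refl)) r = trans (Rounds.block-b k r) (sym (Rounds.block-a k r))
        rootEdgeᵇ≡true : rootEdgeᵇ u v ≡ true
        rootEdgeᵇ≡true with isRootEdge? u v
        ... | yes _       = refl
        ... | no notRoot = ⊥-elim (notRoot root)
        coef≡w : coef u v ≡ w u v
        coef≡w = begin
          coef u v                                      ≡⟨ coef≡ (term≡w (adj G) uv u<v)
                                                                  (term≡w (adj T) (rootEdge-adj root) u<v)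
                                                                  (term≡w rootEdgeᵇ rootEdgeᵇ≡true u<v) ⟩
          ½ * w u v + coefA K * w u v + coefB K * w u v ≡⟨ collect ½ (coefA K) (coefB K) (w u v) ⟩
          (½ + coefA K + coefB K) * w u v               ≡⟨ cong (_* w u v) coef-rootEdge ⟩
          1ℚ * w u v                                    ≡⟨ *-identityˡ (w u v) ⟩
          w u v                                         ∎
          where
          open ≡-Reasoning
          collect : ∀ h a c x → h * x + a * x + c * x ≡ (h + a + c) * x
          collect = solve 4 (λ h a c x → h :* x :+ a :* x :+ c :* x := (h :+ a :+ c) :* x) refl

      treeEdge-bound : ¬ IsRootEdge u v → adj T u v ≡ true → ι K * coef u v ≤ ∑< K (λ r → gain r u v)
      treeEdge-bound notRoot uvT = subst (_≤ ∑< K (λ r → gain r u v)) (sym ι*coef)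
        (∑<-≥-except K (m%n<n (proj₁ level) K)
           (λ r _ r≢r₀ → ≤-reflexive (sym (gain-sameBlock r (proj₂ level r r≢r₀) differ)))
           (gain-half _ differ))
        where
        differ = colour-≢ uvT
        -- The edge joins levels d and d + 1, so only round d mod K separates its ends.
        level : ∃[ d ] ∀ r → r ≢ d % K → block r u ≡ block r v
        level with treeEdge⇒parent uvT notRoot
        ... | inj₁ (d , eq , pv≡u) = d , λ r r≢ →
                subst (λ x → block r x ≡ block r v) pv≡u (sym (Rounds.block-parent k r eq (r≢ ∘′ sym)))
        ... | inj₂ (d , eq , pu≡v) = d , λ r r≢ →
                trans (Rounds.block-parent k r eq (r≢ ∘′ sym)) (cong (block r) pu≡v)
        rootEdgeᵇ≡false : rootEdgeᵇ u v ≡ false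
        rootEdgeᵇ≡false with isRootEdge? u v
        ... | yes root = ⊥-elim (notRoot root)
        ... | no _     = refl
        ι*coef : ι K * coef u v ≡ ι K * w u v - (w u v - ½ * w u v)
        ι*coef = begin
          ι K * coef u v                                      ≡⟨ cong (ι K *_) (coef≡ (term≡w (adj G) uv u<v)
                                                                   (term≡w (adj T) uvT u<v)
                                                                   (term≡0 rootEdgeᵇ (cong (_∧ lt u v) rootEdgeᵇ≡false))) ⟩
          ι K * (½ * w u v + coefA K * w u v + coefB K * 0ℚ) ≡⟨ collect (ι K) (coefA K) (coefB K) (w u v) ⟩
          ι K * (½ + coefA K) * w u v                         ≡⟨ cong (_* w u v) coef-treeEdge ⟩
          (ι K - ½) * w u v                                   ≡⟨ spread (ι K) (w u v) ⟩
          ι K * w u v - (w u v - ½ * w u v)                   ∎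
          where
          open ≡-Reasoning
          collect : ∀ y a c x → y * (½ * x + a * x + c * 0ℚ) ≡ y * (½ + a) * x
          collect = solve 4 (λ y a c x → y :* (con ½ :* x :+ a :* x :+ c :* con 0ℚ)
                                      := y :* (con ½ :+ a) :* x) refl
          spread : ∀ y x → (y - ½) * x ≡ y * x - (x - ½ * x)
          spread = solve 2 (λ y x → (y :- con ½) :* x := y :* x :- (x :- con ½ :* x)) refl

      nonTreeEdge-bound : adj T u v ≡ false → ι K * coef u v ≤ ∑< K (λ r → gain r u v)
      nonTreeEdge-bound uvT = subst (_≤ ∑< K (λ r → gain r u v)) (cong (ι K *_) (sym coef≡half))
                                (∑<-≥-const K half≤gain)
        where
        T∧lt≡false : adj T u v ∧ lt u v ≡ false
        T∧lt≡false rewrite uvT = refl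
        coef≡half : coef u v ≡ ½ * w u v
        coef≡half = trans (coef≡ (term≡w (adj G) uv u<v) (term≡0 (adj T) T∧lt≡false)
                                 (term≡0 rootEdgeᵇ (∧-⊆ _ rootEdgeᵇ⇒adj T∧lt≡false)))
                          (drop (coefA K) (coefB K) (w u v))
          where
          drop : ∀ a c x → ½ * x + a * 0ℚ + c * 0ℚ ≡ ½ * x
          drop = solve 3 (λ a c x → con ½ :* x :+ a :* con 0ℚ :+ c :* con 0ℚ := con ½ :* x) refl
        u≢v : u ≢ v
        u≢v refl with () ← trans (sym uv) (Graph.irrefl G u)
        -- Same block and same colour would close an odd cycle of length at most 2K - 1.
        half≤gain : ∀ r → r ℕ.< K → ½ * w u v ≤ gain r u v
        half≤gain r r<K with colour u ℙ.≟ colour v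
        ... | no differ = gain-half r differ
        ... | yes same with block r u ≟ᶠ block r v
        ...   | no  split     = ≤-reflexive (sym (gain-splitBlock r split))
        ...   | yes sameBlock = ⊥-elim (noShortOddCycle u v uv uvT
                (Rounds.sameBlock⇒shortOddCycle k r (ℕᵖ.≤-pred r<K) u≢v sameBlock same))

      edge-bound : ι K * coef u v ≤ ∑< K (λ r → gain r u v)
      edge-bound = byKind (isRootEdge? u v) (adj T u v Bool.≟ true)
        where
        byKind : Dec (IsRootEdge u v) → Dec (adj T u v ≡ true) →
                 ι K * coef u v ≤ ∑< K (λ r → gain r u v)
        byKind (yes root)    _          = rootEdge-bound root
        byKind (no  notRoot) (yes uvT)  = treeEdge-bound notRoot uvT
        byKind (no  _)       (no  ¬uvT) = nonTreeEdge-bound (¬-not ¬uvT)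

    pair-bound : ∀ u v → ι K * coef u v ≤ ∑< K (λ r → gain r u v)
    pair-bound u v with adj G u v Bool.≟ true | lt u v Bool.≟ true
    ... | yes uv | yes u<v = edge-bound uv u<v
    ... | yes uv | no  u≮v = nonEdge-bound (cong₂ _∧_ uv (¬-not u≮v))
    ... | no ¬uv | _       = nonEdge-bound (cong (_∧ lt u v) (¬-not ¬uv))

    module _ (w-sym : ∀ u v → w u v ≡ w v u) where

      private
        tG = term (adj G)
        tT = term (adj T)
        tR = term rootEdgeᵇ

        term-nonNeg : ∀ P u v → 0ℚ ≤ term P u v
        term-nonNeg P u v with P u v ∧ lt u v
        ... | true  = w-nonNeg u v
        ... | false = ≤-refl

        lt-true : ∀ {u v} → toℕ u ℕ.< toℕ v → lt u v ≡ true
        lt-true {u} {v} u<v with toℕ u ℕ.<? toℕ v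
        ... | yes _   = refl
        ... | no  u≮v = ⊥-elim (u≮v u<v)

        rootTerm : ∀ {u v} → IsRootEdge u v → toℕ u ℕ.< toℕ v → tR u v ≡ w u v
        rootTerm {u} {v} root u<v with isRootEdge? u v
        ... | yes _       = cong (λ l → if l then w u v else 0ℚ) (lt-true u<v)
        ... | no notRoot = ⊥-elim (notRoot root)

      w[ab]≤ : w a b ≤ Σ² tR
      w[ab]≤ with ℕᵖ.<-cmp (toℕ a) (toℕ b)
      ... | tri< a<b _ _ = subst (_≤ Σ² tR) (rootTerm (inj₁ (refl , refl)) a<b)
                                   (Σ²-≥-term (term-nonNeg rootEdgeᵇ) a b)
      ... | tri≈ _ a≡b _ = ⊥-elim (adj⇒≢ ab (toℕ-injective a≡b))
      ... | tri> _ _ b<a = subst (_≤ Σ² tR) (trans (rootTerm (inj₂ (refl , refl)) b<a) (w-sym b a))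
                                   (Σ²-≥-term (term-nonNeg rootEdgeᵇ) b a)

      Σ²-coef : Σ² coef ≡ ½ * weight (adj G) w + coefA K * weight (adj T) w + coefB K * Σ² tR
      Σ²-coef = begin
        Σ² coef
          ≡⟨ Σ²-distrib-+ (λ u v → ½ * tG u v + coefA K * tT u v) _ ⟩
        Σ² (λ u v → ½ * tG u v + coefA K * tT u v) + Σ² (λ u v → coefB K * tR u v)
          ≡⟨ cong₂ _+_ (Σ²-distrib-+ (λ u v → ½ * tG u v) _) (Σ²-*ˡ (coefB K) tR) ⟩
        Σ² (λ u v → ½ * tG u v) + Σ² (λ u v → coefA K * tT u v) + coefB K * Σ² tR
          ≡⟨ cong (_+ coefB K * Σ² tR) (cong₂ _+_ (Σ²-*ˡ ½ tG) (Σ²-*ˡ (coefA K) tT)) ⟩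
        ½ * Σ² tG + coefA K * Σ² tT + coefB K * Σ² tR
          ∎
        where open ≡-Reasoning

      expectedCut : ∀ r → 𝔼 n (λ s → cutWeight G w (side r s)) ≡ Σ² (gain r)
      expectedCut r = trans (𝔼-cong n λ s → cutWeight-xor G w (side r s)) (𝔼-Σ² n (crossing r))

      bound : ℚ
      bound = ½ * weight (adj G) w + coefA K * weight (adj T) w + coefB K * w a b

      bound≤Σ²coef : bound ≤ Σ² coef
      bound≤Σ²coef = subst (bound ≤_) (sym Σ²-coef)
        (+-monoʳ-≤ (½ * weight (adj G) w + coefA K * weight (adj T) w)
                   (*-monoˡ-≤-nonNeg (coefB K) {{coefB-nonNeg}} w[ab]≤))

      averageCut : ι K * bound ≤ ∑< K (λ r → 𝔼 n (λ s → cutWeight G w (side r s)))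
      averageCut = begin
        ι K * bound                                         ≤⟨ *-monoˡ-≤-nonNeg (ι K) {{ι-nonNeg K}} bound≤Σ²coef ⟩
        ι K * Σ² coef                                       ≡⟨ sym (Σ²-*ˡ (ι K) coef) ⟩
        Σ² (λ u v → ι K * coef u v)                        ≤⟨ Σ²-mono-≤ pair-bound ⟩
        Σ² (λ u v → ∑< K (λ r → gain r u v))               ≡⟨ sym (∑<-Σ² K gain) ⟩
        ∑< K (λ r → Σ² (gain r))                           ≡⟨ ∑<-cong K (λ r → sym (expectedCut r)) ⟩
        ∑< K (λ r → 𝔼 n (λ s → cutWeight G w (side r s))) ∎
        where open ≤-Reasoning

open import Defs
open Sums using (∑<-average; 𝔼-average)
open Cuts using (module CutAnalysis)
open import Data.Nat using (ℕ; NonZero; _*_; _∸_; suc)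
open import Data.Fin using (Fin)
open import Data.Bool using (false)
open import Data.Rational using (ℚ; 0ℚ; ½; _≤_; _+_)
open import Data.Product using (_,_)
open import Relation.Binary.PropositionalEquality using (_≡_)
open import Relation.Nullary using (¬_)

lemma6p1 : (k : ℕ) → .{{_ : NonZero k}} → (n : ℕ) → (G : Graph n)
    → Connected (adj G)
    → (w : Fin n → Fin n → ℚ)
    → (∀ u v → w u v ≡ w v u) → (∀ u v → 0ℚ ≤ w u v)
    → (T : Graph n) → SpanningTree G T
    → (a b : Fin n) → Adj (adj T) a b
    → (∀ x y → Adj (adj G) x y → adj T x y ≡ false
         → ¬ HasShortOddCycle (addEdge (adj T) x y) (2 * k ∸ 1))
    → MacAtLeast G w
        (½ Data.Rational.* weight (adj G) w
          + coefA k Data.Rational.* weight (adj T) w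
          + coefB k Data.Rational.* w a b)
lemma6p1 (suc k) n G _ w w-sym w-nonNeg T tree a b ab noShortOddCycle =
  let r , _ , bound≤𝔼 = ∑<-average k (averageCut w-sym)
      s , bound≤cut   = 𝔼-average n bound≤𝔼
  in side r s , bound≤cut
  where open CutAnalysis k G w w-nonNeg T tree ab noShortOddCycle
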